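{- Let $f\in\mathbb{Q}(x)$ be a normalized Belyi map of combinatorial type $(d; e_1,e_2,e_3)$ and let $p$ be a prime. Assume that the reduction $\overline{f}$ of $f$ modulo $p$ is separable (i.e. $\overline{f}\notin\overline{\mathbb{F}}_p(x^p)$). Then (a) $\deg(\overline{f}) = d$, i.e. $f$ has good reduction at $p$, and (b) $p\nmid e_i$ for $i=1,2,3$.
   Context: A normalized Belyi map of combinatorial type $(d; e_1,e_2,e_3)$ (with integers $2\le e_i\le d$, $e_1+e_2+e_3=2d+1$) is a rational function $f$ of degree $d$, viewed as a map $\mathbb{P}^1\to\mathbb{P}^1$ over $\mathbb{C}$, whose only ramification points are $0,1,\infty$, with ramification indices $e_1,e_2,e_3$ respectively, and with $f(0)=0$, $f(1)=1$, $f(\infty)=\infty$; such $f$ has rational coefficients. Reduction modulo $p$: write $f=f_1/f_2$ with $f_1,f_2\in\mathbb{Z}[x]$ relatively prime, and $f_k = c_k\tilde f_k$ with $c_k$ a nonzero integer and $\tilde f_k\in\mathbb{Z}[x]$ of content $1$. Let $\overline{f}_k\in\mathbb{F}_p[x]$ be the reduction of $\tilde f_k$ and $\overline{f}=\overline{f}_1/\overline{f}_2\in\mathbb{F}_p(x)$ as a rational function (common factors cancelled). $f$ has good reduction at $p$ if $\deg\overline{f}=d$, and bad reduction otherwise. -}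

module Defs where

open import Data.Nat as ℕ using (ℕ; zero; suc; _⊔_; _∸_)
open import Data.Integer as ℤ using (ℤ; +_; -_; _+_; _-_; _*_; -1ℤ; 0ℤ; 1ℤ)
open import Data.Integer.Divisibility using (_∣_)
open import Data.List using (List; []; _∷_; map)
open import Data.Product using (Σ; ∃; ∃-syntax; _×_)
open import Data.Sum using (_⊎_)
open import Relation.Nullary using (¬_)
open import Relation.Binary.PropositionalEquality using (_≡_; _≢_)

-- Polynomials in ℤ[x]: coefficient lists, lowest degree first.
-- Trailing zeros are allowed; equality is taken up to them (_≈ₚ_).

Poly : Set
Poly = List ℤ

coeff : Poly → ℕ → ℤ
coeff []       _       = 0ℤ
coeff (a ∷ _)  zero    = a
coeff (_ ∷ p)  (suc i) = coeff p i

infixl 6 _+ₚ_ _-ₚ_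
infixl 7 _*ₚ_

_+ₚ_ : Poly → Poly → Poly
[]      +ₚ q       = q
(a ∷ p) +ₚ []      = a ∷ p
(a ∷ p) +ₚ (b ∷ q) = (a + b) ∷ (p +ₚ q)

scale : ℤ → Poly → Poly
scale c = map (c *_)

negₚ : Poly → Poly
negₚ = map (-_)

_-ₚ_ : Poly → Poly → Poly
p -ₚ q = p +ₚ negₚ q

_*ₚ_ : Poly → Poly → Poly
[]      *ₚ q = []
(a ∷ p) *ₚ q = scale a q +ₚ (0ℤ ∷ (p *ₚ q))

constₚ : ℤ → Poly
constₚ c = c ∷ []

Xₚ : Poly
Xₚ = 0ℤ ∷ 1ℤ ∷ []

X-1ₚ : Poly
X-1ₚ = -1ℤ ∷ 1ℤ ∷ []

_^ₚ_ : Poly → ℕ → Poly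
p ^ₚ zero  = constₚ 1ℤ
p ^ₚ suc n = p *ₚ (p ^ₚ n)

derivAux : ℕ → Poly → Poly
derivAux n []      = []
derivAux n (b ∷ p) = (+ n * b) ∷ derivAux (suc n) p

deriv : Poly → Poly
deriv []      = []
deriv (_ ∷ p) = derivAux 1 p

eval : Poly → ℤ → ℤ
eval []      x = 0ℤ
eval (a ∷ p) x = a + x * eval p x

-- Wronskian f1' f2 - f1 f2'  (numerator of the derivative of f1/f2)
wronski : Poly → Poly → Poly
wronski f₁ f₂ = deriv f₁ *ₚ f₂ -ₚ f₁ *ₚ deriv f₂

IsZeroₚ : Poly → Set
IsZeroₚ p = ∀ i → coeff p i ≡ 0ℤ

infix 4 _≈ₚ_ _∣ₚ_
_≈ₚ_ : Poly → Poly → Set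
p ≈ₚ q = IsZeroₚ (p -ₚ q)

HasDeg : Poly → ℕ → Set
HasDeg p n = coeff p n ≢ 0ℤ × (∀ i → n ℕ.< i → coeff p i ≡ 0ℤ)

_∣ₚ_ : Poly → Poly → Set
g ∣ₚ f = ∃[ q ] (f ≈ₚ g *ₚ q)

RelPrime : Poly → Poly → Set
RelPrime f₁ f₂ = ∀ g → g ∣ₚ f₁ → g ∣ₚ f₂ → (g ≈ₚ constₚ 1ℤ ⊎ g ≈ₚ constₚ -1ℤ)

Primitive : Poly → Set
Primitive g = ∀ (m : ℕ) → (∀ i → + m ∣ coeff g i) → m ≡ 1

-- Normalized Belyi map f = f₁/f₂ (f₁, f₂ ∈ ℤ[x] relatively prime)
-- of combinatorial type (d; e₁, e₂, e₃).

record IsNormBelyi (d e₁ e₂ e₃ : ℕ) (f₁ f₂ : Poly) : Set where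
  field
    e₁-range : 2 ℕ.≤ e₁ × e₁ ℕ.≤ d
    e₂-range : 2 ℕ.≤ e₂ × e₂ ℕ.≤ d
    e₃-range : 2 ℕ.≤ e₃ × e₃ ℕ.≤ d
    e-sum    : e₁ ℕ.+ e₂ ℕ.+ e₃ ≡ 2 ℕ.* d ℕ.+ 1
    coprime  : RelPrime f₁ f₂
    -- deg f = d, f(∞) = ∞ with ramification index e₃ = deg f₁ - deg f₂
    deg-f₁   : HasDeg f₁ d
    deg-f₂   : HasDeg f₂ (d ∸ e₃)
    -- f(0) = 0 with ramification index e₁: ord₀ f₁ = e₁
    ram-0    : (∀ i → i ℕ.< e₁ → coeff f₁ i ≡ 0ℤ) × coeff f₁ e₁ ≢ 0ℤ
    -- f(1) = 1 with ramification index e₂: ord₁ (f₁ - f₂) = e₂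
    ram-1    : ∃[ q ] ((f₁ -ₚ f₂ ≈ₚ (X-1ₚ ^ₚ e₂) *ₚ q) × eval q 1ℤ ≢ 0ℤ)
    -- no other ramification points: the Wronskian f₁'f₂ - f₁f₂' (whose
    -- order at a finite point a equals e_a - 1) vanishes only at 0 and 1
    unram    : ∃[ c ] (c ≢ 0ℤ ×
                 wronski f₁ f₂ ≈ₚ scale c ((Xₚ ^ₚ (e₁ ∸ 1)) *ₚ (X-1ₚ ^ₚ (e₂ ∸ 1))))

-- Polynomials over 𝔽_p, represented by integer polynomials up to
-- congruence of coefficients modulo p.

ZeroMod : ℕ → Poly → Set
ZeroMod p q = ∀ i → + p ∣ coeff q i

HasDegMod : ℕ → Poly → ℕ → Set
HasDegMod p q n = ¬ (+ p ∣ coeff q n) × (∀ i → n ℕ.< i → + p ∣ coeff q i)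

DivMod : ℕ → Poly → Poly → Set
DivMod p g u = ∃[ q ] ZeroMod p (u -ₚ g *ₚ q)

CoprimeMod : ℕ → Poly → Poly → Set
CoprimeMod p u₁ u₂ = ∀ g → DivMod p g u₁ → DivMod p g u₂ → HasDegMod p g 0

-- the rational function ḡ₁/ḡ₂ ∈ 𝔽_p(x) has degree n: after cancelling
-- the common factor h, ḡ₁ = h ū₁, ḡ₂ = h ū₂ with ū₁, ū₂ coprime, and
-- n = max(deg ū₁, deg ū₂).
RatDegMod : ℕ → Poly → Poly → ℕ → Set
RatDegMod p g₁ g₂ n =
  ∃[ h ] ∃[ u₁ ] ∃[ u₂ ]
    ( ZeroMod p (g₁ -ₚ h *ₚ u₁) × ZeroMod p (g₂ -ₚ h *ₚ u₂)
    × CoprimeMod p u₁ u₂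
    × ∃[ n₁ ] ∃[ n₂ ] (HasDegMod p u₁ n₁ × HasDegMod p u₂ n₂ × n ≡ n₁ ⊔ n₂))

-- ḡ₁/ḡ₂ is separable, i.e. not in 𝔽̄_p(x^p), i.e. its derivative
-- (numerator ḡ₁'ḡ₂ - ḡ₁ḡ₂') is nonzero in 𝔽_p(x).
SeparableMod : ℕ → Poly → Poly → Set
SeparableMod p g₁ g₂ = ¬ ZeroMod p (wronski g₁ g₂)

{-# OPTIONS --safe #-}
module Submission where

-- Write f₁ = c₁ g₁ and f₂ = c₂ g₂. Since f is unramified outside 0, 1 and ∞, the Wronskian
-- f₁′f₂ − f₁f₂′ equals c x^(e₁−1) (x−1)^(e₂−1); comparing leading coefficients shows that
-- g₁′g₂ − g₁g₂′ = w x^(e₁−1) (x−1)^(e₂−1) with w = e₃ · lc(g₁) · lc(g₂). Separability of ḡ₁/ḡ₂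
-- means exactly that p ∤ w, whence p ∤ e₃ and deg ḡ₁ = d. The coefficient of x^(e₁−1) gives
-- p ∤ e₁ and ḡ₂(0) ≠ 0. Dividing the Wronskian of f₁ − f₂ = (x−1)^e₂ q and f₂ by (x−1)^(e₂−1)
-- and evaluating at 1 gives c = e₂ q(1) f₂(1); as p cannot divide both c₁ and c₂ (f₁ and f₂ are
-- coprime), this yields p ∤ e₂ and ḡ₁(1) ≠ 0 or ḡ₂(1) ≠ 0. A common factor h of ḡ₁ and ḡ₂ divides
-- their Wronskian w̄ x^(e₁−1) (x−1)^(e₂−1) but vanishes at neither 0 nor 1, so h is a constant:
-- ḡ₁/ḡ₂ is already in lowest terms and has degree max(d, deg ḡ₂) = d.

open import Defs
open import Data.Nat as ℕ using (ℕ; zero; suc; s≤s; z≤n; _∸_)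
import Data.Nat.Properties as ℕ
open import Data.Integer as ℤ using (ℤ; +_; -_; _+_; _-_; _*_; _^_; 0ℤ; 1ℤ; -1ℤ)
import Data.Integer.Properties as ℤ
open import Data.Integer.Tactic.RingSolver using (solve-∀)
open import Data.Nat.Tactic.RingSolver using () renaming (solve-∀ to ℕ-solve-∀)
open import Data.List using ([]; _∷_)
open import Data.List.Properties using (map-cong)
open import Data.Integer.Divisibility.Signed
  using (divides; ∣m∣n⇒∣m+n; ∣m⇒∣-m; ∣m∣n⇒∣m-n; ∣m⇒∣m*n; ∣n⇒∣m*n; _∣?_; 0∣⇒≡0; ∣ᵤ⇒∣; ∣⇒∣ᵤ)
  renaming (_∣_ to _∣ℤ_)
open import Data.Nat.Divisibility using (_∣_; ∣1⇒≡1)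
open import Data.Nat.Primality using (Prime; euclidsLemma; ¬prime[1])
import Data.Maybe
open import Data.Maybe using (Maybe; just; nothing)
open import Data.Product using (∃; _×_; _,_; proj₁; proj₂)
import Data.Sum
open import Data.Sum using (_⊎_; inj₁; inj₂; [_,_]′)
open import Data.Empty using (⊥; ⊥-elim)
open import Relation.Nullary using (¬_; yes; no)
open import Algebra.Bundles using (CommutativeRing)
import Tactic.RingSolver.Core.AlmostCommutativeRing as ACR
import Relation.Binary.Reasoning.Setoid
open import Function using (_∘_; id; case_of_)
open import Relation.Binary.PropositionalEquality
  using (_≡_; _≢_; refl; sym; trans; cong; cong₂; subst; module ≡-Reasoning)

-- Records rather than pointwise function types (here and for _≈_ below), so that the
-- polynomials can be inferred.
infix 4 _≐_
record _≐_ (a b : Poly) : Set where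
  constructor coeffwise
  field coeff-≡ : ∀ i → coeff a i ≡ coeff b i
open _≐_

≐-sym : ∀ {a b} → a ≐ b → b ≐ a
≐-sym a≐b = coeffwise (sym ∘ coeff-≡ a≐b)

≐-trans : ∀ {a b c} → a ≐ b → b ≐ c → a ≐ c
≐-trans a≐b b≐c = coeffwise λ i → trans (coeff-≡ a≐b i) (coeff-≡ b≐c i)

coeff-+ₚ : ∀ a b i → coeff (a +ₚ b) i ≡ coeff a i + coeff b i
coeff-+ₚ []      b       i       = sym (ℤ.+-identityˡ _)
coeff-+ₚ (x ∷ a) []      i       = sym (ℤ.+-identityʳ _)
coeff-+ₚ (x ∷ a) (y ∷ b) zero    = refl
coeff-+ₚ (x ∷ a) (y ∷ b) (suc i) = coeff-+ₚ a b i

coeff-scale : ∀ c a i → coeff (scale c a) i ≡ c * coeff a i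
coeff-scale c []      i       = sym (ℤ.*-zeroʳ c)
coeff-scale c (x ∷ a) zero    = refl
coeff-scale c (x ∷ a) (suc i) = coeff-scale c a i

coeff-negₚ : ∀ a i → coeff (negₚ a) i ≡ - coeff a i
coeff-negₚ []      i       = refl
coeff-negₚ (x ∷ a) zero    = refl
coeff-negₚ (x ∷ a) (suc i) = coeff-negₚ a i

coeff-subₚ : ∀ a b i → coeff (a -ₚ b) i ≡ coeff a i - coeff b i
coeff-subₚ a b i = trans (coeff-+ₚ a (negₚ b) i) (cong (_+_ (coeff a i)) (coeff-negₚ b i))

coeff-∷*ₚ : ∀ x a b i → coeff ((x ∷ a) *ₚ b) i ≡ x * coeff b i + coeff (0ℤ ∷ a *ₚ b) i
coeff-∷*ₚ x a b i = trans (coeff-+ₚ (scale x b) _ i) (cong (_+ _) (coeff-scale x b i))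

0∷-cong : ∀ {a b} → a ≐ b → (0ℤ ∷ a) ≐ (0ℤ ∷ b)
0∷-cong a≐b = coeffwise λ { zero → refl ; (suc i) → coeff-≡ a≐b i }

coeff-0∷[] : ∀ i → coeff (0ℤ ∷ []) i ≡ 0ℤ
coeff-0∷[] zero    = refl
coeff-0∷[] (suc i) = refl

*ₚ-zeroʳ : ∀ a → a *ₚ [] ≐ []
*ₚ-zeroʳ []      = coeffwise λ i → refl
*ₚ-zeroʳ (x ∷ a) = coeffwise λ i → begin
  coeff ((x ∷ a) *ₚ []) i          ≡⟨ coeff-∷*ₚ x a [] i ⟩
  x * 0ℤ + coeff (0ℤ ∷ a *ₚ []) i  ≡⟨ cong₂ _+_ (ℤ.*-zeroʳ x) (coeff-≡ (0∷-cong (*ₚ-zeroʳ a)) i) ⟩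
  0ℤ + coeff (0ℤ ∷ []) i           ≡⟨ ℤ.+-identityˡ _ ⟩
  coeff (0ℤ ∷ []) i                ≡⟨ coeff-0∷[] i ⟩
  0ℤ                               ∎
  where open ≡-Reasoning

coeff-*ₚ∷ : ∀ a y b i → coeff (a *ₚ (y ∷ b)) i ≡ y * coeff a i + coeff (0ℤ ∷ a *ₚ b) i
coeff-*ₚ∷ []      y b zero    = sym (trans (ℤ.+-identityʳ _) (ℤ.*-zeroʳ y))
coeff-*ₚ∷ []      y b (suc i) = sym (trans (ℤ.+-identityʳ _) (ℤ.*-zeroʳ y))
coeff-*ₚ∷ (x ∷ a) y b zero    = trans (coeff-∷*ₚ x a (y ∷ b) zero) (cong (_+ 0ℤ) (ℤ.*-comm x y))
coeff-*ₚ∷ (x ∷ a) y b (suc i) = begin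
  coeff ((x ∷ a) *ₚ (y ∷ b)) (suc i)               ≡⟨ coeff-∷*ₚ x a (y ∷ b) (suc i) ⟩
  x * coeff b i + coeff (a *ₚ (y ∷ b)) i           ≡⟨ cong (_+_ (x * coeff b i)) (coeff-*ₚ∷ a y b i) ⟩
  x * coeff b i + (y * coeff a i + coeff (0ℤ ∷ a *ₚ b) i) ≡⟨ swap (x * coeff b i) (y * coeff a i) _ ⟩
  y * coeff a i + (x * coeff b i + coeff (0ℤ ∷ a *ₚ b) i) ≡⟨ cong (_+_ (y * coeff a i)) (coeff-∷*ₚ x a b i) ⟨
  y * coeff a i + coeff ((x ∷ a) *ₚ b) i           ∎
  where
  open ≡-Reasoning
  swap : ∀ u v w → u + (v + w) ≡ v + (u + w)
  swap = solve-∀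

*ₚ-comm : ∀ a b → a *ₚ b ≐ b *ₚ a
*ₚ-comm []      b = coeffwise λ i → sym (coeff-≡ (*ₚ-zeroʳ b) i)
*ₚ-comm (x ∷ a) b = coeffwise λ i → begin
  coeff ((x ∷ a) *ₚ b) i                ≡⟨ coeff-∷*ₚ x a b i ⟩
  x * coeff b i + coeff (0ℤ ∷ a *ₚ b) i ≡⟨ cong (_+_ (x * coeff b i)) (coeff-≡ (0∷-cong (*ₚ-comm a b)) i) ⟩
  x * coeff b i + coeff (0ℤ ∷ b *ₚ a) i ≡⟨ coeff-*ₚ∷ b x a i ⟨
  coeff (b *ₚ (x ∷ a)) i                ∎
  where open ≡-Reasoning

*ₚ-distribʳ : ∀ a a′ b → (a +ₚ a′) *ₚ b ≐ a *ₚ b +ₚ a′ *ₚ b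
*ₚ-distribʳ []      a′       b = coeffwise λ i → refl
*ₚ-distribʳ (x ∷ a) []       b = coeffwise λ i → sym (trans (coeff-+ₚ ((x ∷ a) *ₚ b) [] i) (ℤ.+-identityʳ _))
*ₚ-distribʳ (x ∷ a) (y ∷ a′) b = coeffwise λ i → begin
  coeff ((x + y ∷ a +ₚ a′) *ₚ b) i
    ≡⟨ coeff-∷*ₚ (x + y) (a +ₚ a′) b i ⟩
  (x + y) * coeff b i + coeff (0ℤ ∷ (a +ₚ a′) *ₚ b) i
    ≡⟨ cong (_+_ ((x + y) * coeff b i)) (tail i) ⟩
  (x + y) * coeff b i + (coeff (0ℤ ∷ a *ₚ b) i + coeff (0ℤ ∷ a′ *ₚ b) i)
    ≡⟨ regroup x y (coeff b i) _ _ ⟩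
  (x * coeff b i + coeff (0ℤ ∷ a *ₚ b) i) + (y * coeff b i + coeff (0ℤ ∷ a′ *ₚ b) i)
    ≡⟨ cong₂ _+_ (coeff-∷*ₚ x a b i) (coeff-∷*ₚ y a′ b i) ⟨
  coeff ((x ∷ a) *ₚ b) i + coeff ((y ∷ a′) *ₚ b) i
    ≡⟨ coeff-+ₚ ((x ∷ a) *ₚ b) ((y ∷ a′) *ₚ b) i ⟨
  coeff ((x ∷ a) *ₚ b +ₚ (y ∷ a′) *ₚ b) i ∎
  where
  open ≡-Reasoning
  regroup : ∀ x y z s t → (x + y) * z + (s + t) ≡ (x * z + s) + (y * z + t)
  regroup = solve-∀
  tail : ∀ i → coeff (0ℤ ∷ (a +ₚ a′) *ₚ b) i ≡ coeff (0ℤ ∷ a *ₚ b) i + coeff (0ℤ ∷ a′ *ₚ b) i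
  tail zero    = refl
  tail (suc i) = trans (coeff-≡ (*ₚ-distribʳ a a′ b) i) (coeff-+ₚ (a *ₚ b) (a′ *ₚ b) i)

coeff-0∷-scale : ∀ c a i → coeff (0ℤ ∷ scale c a) i ≡ c * coeff (0ℤ ∷ a) i
coeff-0∷-scale c a zero    = sym (ℤ.*-zeroʳ c)
coeff-0∷-scale c a (suc i) = coeff-scale c a i

scale-*ₚ : ∀ c a b → scale c a *ₚ b ≐ scale c (a *ₚ b)
scale-*ₚ c []      b = coeffwise λ i → trans (sym (ℤ.*-zeroʳ c)) (sym (coeff-scale c [] i))
scale-*ₚ c (x ∷ a) b = coeffwise λ i → begin
  coeff ((c * x ∷ scale c a) *ₚ b) i
    ≡⟨ coeff-∷*ₚ (c * x) (scale c a) b i ⟩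
  c * x * coeff b i + coeff (0ℤ ∷ scale c a *ₚ b) i
    ≡⟨ cong (_+_ (c * x * coeff b i)) (trans (coeff-≡ (0∷-cong (scale-*ₚ c a b)) i) (coeff-0∷-scale c (a *ₚ b) i)) ⟩
  c * x * coeff b i + c * coeff (0ℤ ∷ a *ₚ b) i
    ≡⟨ factor c x (coeff b i) _ ⟩
  c * (x * coeff b i + coeff (0ℤ ∷ a *ₚ b) i)
    ≡⟨ cong (c *_) (coeff-∷*ₚ x a b i) ⟨
  c * coeff ((x ∷ a) *ₚ b) i
    ≡⟨ coeff-scale c ((x ∷ a) *ₚ b) i ⟨
  coeff (scale c ((x ∷ a) *ₚ b)) i ∎
  where
  open ≡-Reasoning
  factor : ∀ c x y s → c * x * y + c * s ≡ c * (x * y + s)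
  factor = solve-∀

*ₚ-assoc : ∀ a b c → (a *ₚ b) *ₚ c ≐ a *ₚ (b *ₚ c)
*ₚ-assoc []      b c = coeffwise λ i → refl
*ₚ-assoc (x ∷ a) b c = coeffwise λ i → begin
  coeff ((scale x b +ₚ (0ℤ ∷ a *ₚ b)) *ₚ c) i
    ≡⟨ coeff-≡ (*ₚ-distribʳ (scale x b) (0ℤ ∷ a *ₚ b) c) i ⟩
  coeff (scale x b *ₚ c +ₚ (0ℤ ∷ a *ₚ b) *ₚ c) i
    ≡⟨ coeff-+ₚ (scale x b *ₚ c) ((0ℤ ∷ a *ₚ b) *ₚ c) i ⟩
  coeff (scale x b *ₚ c) i + coeff ((0ℤ ∷ a *ₚ b) *ₚ c) i
    ≡⟨ cong₂ _+_ (trans (coeff-≡ (scale-*ₚ x b c) i) (coeff-scale x (b *ₚ c) i)) (coeff-∷*ₚ 0ℤ (a *ₚ b) c i) ⟩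
  x * coeff (b *ₚ c) i + (0ℤ * coeff c i + coeff (0ℤ ∷ (a *ₚ b) *ₚ c) i)
    ≡⟨ cong (_+_ (x * coeff (b *ₚ c) i)) (ℤ.+-identityˡ _) ⟩
  x * coeff (b *ₚ c) i + coeff (0ℤ ∷ (a *ₚ b) *ₚ c) i
    ≡⟨ cong (_+_ (x * coeff (b *ₚ c) i)) (coeff-≡ (0∷-cong (*ₚ-assoc a b c)) i) ⟩
  x * coeff (b *ₚ c) i + coeff (0ℤ ∷ a *ₚ (b *ₚ c)) i
    ≡⟨ coeff-∷*ₚ x a (b *ₚ c) i ⟨
  coeff ((x ∷ a) *ₚ (b *ₚ c)) i ∎
  where open ≡-Reasoning

*ₚ-identityˡ : ∀ a → constₚ 1ℤ *ₚ a ≐ a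
*ₚ-identityˡ a = coeffwise λ i → begin
  coeff ((1ℤ ∷ []) *ₚ a) i         ≡⟨ coeff-∷*ₚ 1ℤ [] a i ⟩
  1ℤ * coeff a i + coeff (0ℤ ∷ []) i ≡⟨ cong₂ _+_ (ℤ.*-identityˡ (coeff a i)) (coeff-0∷[] i) ⟩
  coeff a i + 0ℤ                   ≡⟨ ℤ.+-identityʳ _ ⟩
  coeff a i                        ∎
  where open ≡-Reasoning

negₚ≡scale-1 : ∀ a → negₚ a ≡ scale -1ℤ a
negₚ≡scale-1 = map-cong (sym ∘ ℤ.-1*i≡-i)

negₚ-*ₚ : ∀ a b → negₚ a *ₚ b ≐ negₚ (a *ₚ b)
negₚ-*ₚ a b = coeffwise λ i → begin
  coeff (negₚ a *ₚ b) i       ≡⟨ cong (λ a′ → coeff (a′ *ₚ b) i) (negₚ≡scale-1 a) ⟩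
  coeff (scale -1ℤ a *ₚ b) i  ≡⟨ coeff-≡ (scale-*ₚ -1ℤ a b) i ⟩
  coeff (scale -1ℤ (a *ₚ b)) i ≡⟨ cong (λ c → coeff c i) (negₚ≡scale-1 (a *ₚ b)) ⟨
  coeff (negₚ (a *ₚ b)) i     ∎
  where open ≡-Reasoning

+ₚ-assoc : ∀ a b c → (a +ₚ b) +ₚ c ≐ a +ₚ (b +ₚ c)
+ₚ-assoc a b c = coeffwise λ i → begin
  coeff ((a +ₚ b) +ₚ c) i                ≡⟨ trans (coeff-+ₚ (a +ₚ b) c i) (cong (_+ coeff c i) (coeff-+ₚ a b i)) ⟩
  coeff a i + coeff b i + coeff c i      ≡⟨ ℤ.+-assoc (coeff a i) (coeff b i) (coeff c i) ⟩
  coeff a i + (coeff b i + coeff c i)    ≡⟨ trans (coeff-+ₚ a (b +ₚ c) i) (cong (_+_ (coeff a i)) (coeff-+ₚ b c i)) ⟨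
  coeff (a +ₚ (b +ₚ c)) i                ∎
  where open ≡-Reasoning

+ₚ-comm : ∀ a b → a +ₚ b ≐ b +ₚ a
+ₚ-comm a b = coeffwise λ i → trans (coeff-+ₚ a b i) (trans (ℤ.+-comm (coeff a i) (coeff b i)) (sym (coeff-+ₚ b a i)))

+ₚ-identityʳ : ∀ a → a +ₚ [] ≐ a
+ₚ-identityʳ a = coeffwise λ i → trans (coeff-+ₚ a [] i) (ℤ.+-identityʳ (coeff a i))

+ₚ-inverseˡ : ∀ a → negₚ a +ₚ a ≐ []
+ₚ-inverseˡ a = coeffwise λ i →
  trans (coeff-+ₚ (negₚ a) a i) (trans (cong (_+ coeff a i) (coeff-negₚ a i)) (ℤ.+-inverseˡ (coeff a i)))

+ₚ-inverseʳ : ∀ a → a +ₚ negₚ a ≐ []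
+ₚ-inverseʳ a = coeffwise λ i → trans (coeff-subₚ a a i) (ℤ.+-inverseʳ (coeff a i))

*ₚ-distribˡ : ∀ a b b′ → a *ₚ (b +ₚ b′) ≐ a *ₚ b +ₚ a *ₚ b′
*ₚ-distribˡ a b b′ = coeffwise λ i → begin
  coeff (a *ₚ (b +ₚ b′)) i                    ≡⟨ coeff-≡ (*ₚ-comm a (b +ₚ b′)) i ⟩
  coeff ((b +ₚ b′) *ₚ a) i                    ≡⟨ coeff-≡ (*ₚ-distribʳ b b′ a) i ⟩
  coeff (b *ₚ a +ₚ b′ *ₚ a) i                 ≡⟨ coeff-+ₚ (b *ₚ a) (b′ *ₚ a) i ⟩
  coeff (b *ₚ a) i + coeff (b′ *ₚ a) i        ≡⟨ cong₂ _+_ (coeff-≡ (*ₚ-comm b a) i) (coeff-≡ (*ₚ-comm b′ a) i) ⟩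
  coeff (a *ₚ b) i + coeff (a *ₚ b′) i        ≡⟨ coeff-+ₚ (a *ₚ b) (a *ₚ b′) i ⟨
  coeff (a *ₚ b +ₚ a *ₚ b′) i                 ∎
  where open ≡-Reasoning

decide≐[] : (a : Poly) → Maybe (a ≐ [])
decide≐[] []      = just (coeffwise λ i → refl)
decide≐[] (x ∷ a) with x ℤ.≟ 0ℤ | decide≐[] a
... | yes refl | just a≐[] = just (coeffwise λ { zero → refl ; (suc i) → coeff-≡ a≐[] i })
... | _        | _         = nothing

coeff-derivAux : ∀ n a i → coeff (derivAux n a) i ≡ + (n ℕ.+ i) * coeff a i
coeff-derivAux n []      i       = sym (ℤ.*-zeroʳ (+ (n ℕ.+ i)))
coeff-derivAux n (b ∷ a) zero    = cong (λ k → + k * b) (sym (ℕ.+-identityʳ n))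
coeff-derivAux n (b ∷ a) (suc i) =
  trans (coeff-derivAux (suc n) a i) (cong (λ k → + k * coeff a i) (sym (ℕ.+-suc n i)))

coeff-deriv : ∀ a i → coeff (deriv a) i ≡ + suc i * coeff a (suc i)
coeff-deriv []      i = sym (ℤ.*-zeroʳ (+ suc i))
coeff-deriv (x ∷ a) i = coeff-derivAux 1 a i

Xₚ-*ₚ : ∀ a → Xₚ *ₚ a ≐ 0ℤ ∷ a
Xₚ-*ₚ a = coeffwise λ where
  zero    → trans (coeff-∷*ₚ 0ℤ (1ℤ ∷ []) a 0) (ℤ.+-identityʳ (0ℤ * coeff a 0))
  (suc i) → trans (coeff-∷*ₚ 0ℤ (1ℤ ∷ []) a (suc i)) (trans (ℤ.+-identityˡ _) (coeff-≡ (*ₚ-identityˡ a) i))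

∷≐constₚ+Xₚ*ₚ : ∀ x a → x ∷ a ≐ constₚ x +ₚ Xₚ *ₚ a
∷≐constₚ+Xₚ*ₚ x a = coeffwise λ i → sym (trans (coeff-+ₚ (constₚ x) (Xₚ *ₚ a) i)
                                               (trans (cong (_+_ (coeff (constₚ x) i)) (coeff-≡ (Xₚ-*ₚ a) i)) (split i)))
  where
  split : ∀ i → coeff (constₚ x) i + coeff (0ℤ ∷ a) i ≡ coeff (x ∷ a) i
  split zero    = ℤ.+-identityʳ x
  split (suc i) = ℤ.+-identityˡ _

scale≐constₚ*ₚ : ∀ c a → scale c a ≐ constₚ c *ₚ a
scale≐constₚ*ₚ c a = coeffwise λ i → sym (begin
  coeff ((c ∷ []) *ₚ a) i            ≡⟨ coeff-∷*ₚ c [] a i ⟩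
  c * coeff a i + coeff (0ℤ ∷ []) i  ≡⟨ cong (_+_ (c * coeff a i)) (coeff-0∷[] i) ⟩
  c * coeff a i + 0ℤ                 ≡⟨ ℤ.+-identityʳ _ ⟩
  c * coeff a i                      ≡⟨ coeff-scale c a i ⟨
  coeff (scale c a) i                ∎)
  where open ≡-Reasoning

deriv-+ₚ : ∀ a b → deriv (a +ₚ b) ≐ deriv a +ₚ deriv b
deriv-+ₚ a b = coeffwise λ i → begin
  coeff (deriv (a +ₚ b)) i                           ≡⟨ coeff-deriv (a +ₚ b) i ⟩
  + suc i * coeff (a +ₚ b) (suc i)                   ≡⟨ cong (+ suc i *_) (coeff-+ₚ a b (suc i)) ⟩
  + suc i * (coeff a (suc i) + coeff b (suc i))      ≡⟨ ℤ.*-distribˡ-+ (+ suc i) (coeff a (suc i)) (coeff b (suc i)) ⟩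
  + suc i * coeff a (suc i) + + suc i * coeff b (suc i) ≡⟨ cong₂ _+_ (coeff-deriv a i) (coeff-deriv b i) ⟨
  coeff (deriv a) i + coeff (deriv b) i              ≡⟨ coeff-+ₚ (deriv a) (deriv b) i ⟨
  coeff (deriv a +ₚ deriv b) i                       ∎
  where open ≡-Reasoning

deriv-scale : ∀ c a → deriv (scale c a) ≐ scale c (deriv a)
deriv-scale c a = coeffwise λ i → begin
  coeff (deriv (scale c a)) i        ≡⟨ coeff-deriv (scale c a) i ⟩
  + suc i * coeff (scale c a) (suc i) ≡⟨ cong (+ suc i *_) (coeff-scale c a (suc i)) ⟩
  + suc i * (c * coeff a (suc i))    ≡⟨ ℤ.*-comm (+ suc i) _ ⟩
  c * coeff a (suc i) * + suc i      ≡⟨ ℤ.*-assoc c _ _ ⟩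
  c * (coeff a (suc i) * + suc i)    ≡⟨ cong (c *_) (ℤ.*-comm _ (+ suc i)) ⟩
  c * (+ suc i * coeff a (suc i))    ≡⟨ cong (c *_) (coeff-deriv a i) ⟨
  c * coeff (deriv a) i              ≡⟨ coeff-scale c (deriv a) i ⟨
  coeff (scale c (deriv a)) i        ∎
  where open ≡-Reasoning

deriv-∷ : ∀ x a → deriv (x ∷ a) ≐ a +ₚ Xₚ *ₚ deriv a
deriv-∷ x a = coeffwise λ i → sym (trans (coeff-+ₚ a (Xₚ *ₚ deriv a) i)
                           (trans (cong (_+_ (coeff a i)) (coeff-≡ (Xₚ-*ₚ (deriv a)) i)) (shifted i)))
  where
  shifted : ∀ i → coeff a i + coeff (0ℤ ∷ deriv a) i ≡ coeff (deriv (x ∷ a)) i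
  shifted zero    = trans (ℤ.+-identityʳ _) (sym (trans (coeff-deriv (x ∷ a) 0) (ℤ.*-identityˡ _)))
  shifted (suc i) = begin
    coeff a (suc i) + coeff (deriv a) i              ≡⟨ cong (_+_ (coeff a (suc i))) (coeff-deriv a i) ⟩
    coeff a (suc i) + + suc i * coeff a (suc i)
      ≡⟨ cong (_+ + suc i * coeff a (suc i)) (ℤ.*-identityˡ (coeff a (suc i))) ⟨
    1ℤ * coeff a (suc i) + + suc i * coeff a (suc i) ≡⟨ ℤ.*-distribʳ-+ (coeff a (suc i)) 1ℤ (+ suc i) ⟨
    + suc (suc i) * coeff a (suc i)                  ≡⟨ coeff-deriv (x ∷ a) (suc i) ⟨
    coeff (deriv (x ∷ a)) (suc i)                    ∎
    where open ≡-Reasoning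

eval-+ₚ : ∀ a b x → eval (a +ₚ b) x ≡ eval a x + eval b x
eval-+ₚ []      b       x = sym (ℤ.+-identityˡ _)
eval-+ₚ (y ∷ a) []      x = sym (ℤ.+-identityʳ _)
eval-+ₚ (y ∷ a) (z ∷ b) x =
  trans (cong (λ t → y + z + x * t) (eval-+ₚ a b x)) (regroup y z x (eval a x) (eval b x))
  where
  regroup : ∀ y z x s t → y + z + x * (s + t) ≡ (y + x * s) + (z + x * t)
  regroup = solve-∀

eval-scale : ∀ c a x → eval (scale c a) x ≡ c * eval a x
eval-scale c []      x = sym (ℤ.*-zeroʳ c)
eval-scale c (y ∷ a) x = trans (cong (λ t → c * y + x * t) (eval-scale c a x)) (factor c y x (eval a x))
  where
  factor : ∀ c y x s → c * y + x * (c * s) ≡ c * (y + x * s)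
  factor = solve-∀

eval-negₚ : ∀ a x → eval (negₚ a) x ≡ - eval a x
eval-negₚ a x = trans (cong (λ a′ → eval a′ x) (negₚ≡scale-1 a)) (trans (eval-scale -1ℤ a x) (ℤ.-1*i≡-i _))

eval-subₚ : ∀ a b x → eval (a -ₚ b) x ≡ eval a x - eval b x
eval-subₚ a b x = trans (eval-+ₚ a (negₚ b) x) (cong (_+_ (eval a x)) (eval-negₚ b x))

eval-*ₚ : ∀ a b x → eval (a *ₚ b) x ≡ eval a x * eval b x
eval-*ₚ []      b x = sym (ℤ.*-zeroˡ (eval b x))
eval-*ₚ (y ∷ a) b x = begin
  eval (scale y b +ₚ (0ℤ ∷ a *ₚ b)) x        ≡⟨ eval-+ₚ (scale y b) (0ℤ ∷ a *ₚ b) x ⟩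
  eval (scale y b) x + (0ℤ + x * eval (a *ₚ b) x)
    ≡⟨ cong₂ (λ s t → s + (0ℤ + x * t)) (eval-scale y b x) (eval-*ₚ a b x) ⟩
  y * eval b x + (0ℤ + x * (eval a x * eval b x)) ≡⟨ regroup y x (eval a x) (eval b x) ⟩
  (y + x * eval a x) * eval b x              ∎
  where
  open ≡-Reasoning
  regroup : ∀ y x s t → y * t + (0ℤ + x * (s * t)) ≡ (y + x * s) * t
  regroup = solve-∀

-- X- 0ℤ and X- 1ℤ reduce to Xₚ and X-1ₚ.
X-_ : ℤ → Poly
X- r = - r ∷ 1ℤ ∷ []

Xₚ≐X-+constₚ : ∀ r → Xₚ ≐ X- r +ₚ constₚ r
Xₚ≐X-+constₚ r = coeffwise λ where
  zero          → sym (ℤ.+-inverseˡ r)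
  (suc zero)    → refl
  (suc (suc i)) → refl

eval-X- : ∀ r → eval (X- r) r ≡ 0ℤ
eval-X- r = vanish r
  where
  vanish : ∀ r → - r + r * (1ℤ + r * 0ℤ) ≡ 0ℤ
  vanish = solve-∀

constₚ-*ₚ : ∀ x y → constₚ x *ₚ constₚ y ≐ constₚ (x * y)
constₚ-*ₚ x y = coeffwise λ where
  zero    → ℤ.+-identityʳ (x * y)
  (suc i) → refl

quot : ℤ → Poly → Poly
quot r []      = []
quot r (a ∷ q) = eval q r ∷ quot r q

-- Congruence modulo n in ℤ[x]; for n = 0 it is equality of coefficients.
module Modulo (n : ℕ) where

  Null : ℤ → Set
  Null z = + n ∣ℤ z

  NullPoly : Poly → Set
  NullPoly a = ∀ i → Null (coeff a i)

  infix 4 _≈_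
  record _≈_ (a b : Poly) : Set where
    constructor mk≈
    field coeffs : ∀ i → Null (coeff a i - coeff b i)
  open _≈_ public

  null-0 : Null 0ℤ
  null-0 = divides 0ℤ refl

  ≡0⇒null : ∀ {x} → x ≡ 0ℤ → Null x
  ≡0⇒null refl = null-0

  null-≡ : ∀ {x y} → x ≡ y → Null (x - y)
  null-≡ {x} refl = subst Null (sym (ℤ.+-inverseʳ x)) null-0

  null-≈ˡ : ∀ {x y} → Null (x - y) → Null y → Null x
  null-≈ˡ {x} {y} x≈y ny = subst Null (cancel x y) (∣m∣n⇒∣m+n x≈y ny)
    where
    cancel : ∀ x y → x - y + y ≡ x
    cancel = solve-∀

  null-≈ʳ : ∀ {x y} → Null (x - y) → Null x → Null y
  null-≈ʳ {x} {y} x≈y nx = subst Null (cancel x y) (∣m∣n⇒∣m-n nx x≈y)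
    where
    cancel : ∀ x y → x - (x - y) ≡ y
    cancel = solve-∀

  ≐⇒≈ : ∀ {a b} → a ≐ b → a ≈ b
  ≐⇒≈ a≐b = mk≈ (null-≡ ∘ coeff-≡ a≐b)

  ≈-refl : ∀ {a} → a ≈ a
  ≈-refl = ≐⇒≈ (coeffwise λ i → refl)

  ≈-sym : ∀ {a b} → a ≈ b → b ≈ a
  ≈-sym {a} {b} a≈b = mk≈ λ i → subst Null (flip (coeff a i) (coeff b i)) (∣m⇒∣-m (coeffs a≈b i))
    where
    flip : ∀ x y → - (x - y) ≡ y - x
    flip = solve-∀

  ≈-trans : ∀ {a b c} → a ≈ b → b ≈ c → a ≈ c
  ≈-trans {a} {b} {c} a≈b b≈c =
    mk≈ λ i → subst Null (chain (coeff a i) (coeff b i) (coeff c i)) (∣m∣n⇒∣m+n (coeffs a≈b i) (coeffs b≈c i))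
    where
    chain : ∀ x y z → (x - y) + (y - z) ≡ x - z
    chain = solve-∀

  +-cong : ∀ {a a′ b b′} → a ≈ a′ → b ≈ b′ → a +ₚ b ≈ a′ +ₚ b′
  +-cong {a} {a′} {b} {b′} a≈a′ b≈b′ = mk≈ λ i → subst Null
    (sym (trans (cong₂ _-_ (coeff-+ₚ a b i) (coeff-+ₚ a′ b′ i))
                (regroup (coeff a i) (coeff b i) (coeff a′ i) (coeff b′ i))))
    (∣m∣n⇒∣m+n (coeffs a≈a′ i) (coeffs b≈b′ i))
    where
    regroup : ∀ x y x′ y′ → (x + y) - (x′ + y′) ≡ (x - x′) + (y - y′)
    regroup = solve-∀

  neg-cong : ∀ {a a′} → a ≈ a′ → negₚ a ≈ negₚ a′
  neg-cong {a} {a′} a≈a′ = mk≈ λ i → subst Null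
    (sym (trans (cong₂ _-_ (coeff-negₚ a i) (coeff-negₚ a′ i)) (regroup (coeff a i) (coeff a′ i))))
    (∣m⇒∣-m (coeffs a≈a′ i))
    where
    regroup : ∀ x x′ → - x - - x′ ≡ - (x - x′)
    regroup = solve-∀

  nullPoly-*ₚ : ∀ a b → NullPoly a → NullPoly (a *ₚ b)
  nullPoly-*ₚ []      b na i = null-0
  nullPoly-*ₚ (x ∷ a) b na i =
    subst Null (sym (coeff-∷*ₚ x a b i)) (∣m∣n⇒∣m+n (∣m⇒∣m*n (coeff b i) (na 0)) (shifted i))
    where
    shifted : ∀ i → Null (coeff (0ℤ ∷ a *ₚ b) i)
    shifted zero    = null-0
    shifted (suc i) = nullPoly-*ₚ a b (na ∘ suc) i

  ≈⇒nullPoly-ₚ : ∀ {a b} → a ≈ b → NullPoly (a -ₚ b)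
  ≈⇒nullPoly-ₚ {a} {b} a≈b i = subst Null (sym (coeff-subₚ a b i)) (coeffs a≈b i)

  nullPoly-ₚ⇒≈ : ∀ {a b} → NullPoly (a -ₚ b) → a ≈ b
  nullPoly-ₚ⇒≈ {a} {b} null = mk≈ λ i → subst Null (coeff-subₚ a b i) (null i)

  nullPoly⇒≈[] : ∀ {a} → NullPoly a → a ≈ []
  nullPoly⇒≈[] {a} na = mk≈ λ i → subst Null (sym (ℤ.+-identityʳ (coeff a i))) (na i)

  nullPoly-resp : ∀ {a b} → a ≈ b → NullPoly a → NullPoly b
  nullPoly-resp a≈b na i = null-≈ʳ (coeffs a≈b i) (na i)

  *-congʳ : ∀ {a a′} b → a ≈ a′ → a *ₚ b ≈ a′ *ₚ b
  *-congʳ {a} {a′} b a≈a′ = mk≈ λ i → subst Null (expand i) (nullPoly-*ₚ (a -ₚ a′) b (≈⇒nullPoly-ₚ a≈a′) i)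
    where
    expand : ∀ i → coeff ((a -ₚ a′) *ₚ b) i ≡ coeff (a *ₚ b) i - coeff (a′ *ₚ b) i
    expand i = trans (coeff-≡ (*ₚ-distribʳ a (negₚ a′) b) i) (trans (coeff-+ₚ (a *ₚ b) (negₚ a′ *ₚ b) i)
      (cong (_+_ (coeff (a *ₚ b) i)) (trans (coeff-≡ (negₚ-*ₚ a′ b) i) (coeff-negₚ (a′ *ₚ b) i))))

  *-cong : ∀ {a a′ b b′} → a ≈ a′ → b ≈ b′ → a *ₚ b ≈ a′ *ₚ b′
  *-cong {a} {a′} {b} {b′} a≈a′ b≈b′ =
    ≈-trans (*-congʳ b a≈a′) (≈-trans (≐⇒≈ (*ₚ-comm a′ b)) (≈-trans (*-congʳ a′ b≈b′) (≐⇒≈ (*ₚ-comm b′ a′))))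

  polyRing : CommutativeRing _ _
  polyRing = record
    { Carrier = Poly ; _≈_ = _≈_ ; _+_ = _+ₚ_ ; _*_ = _*ₚ_ ; -_ = negₚ ; 0# = [] ; 1# = constₚ 1ℤ
    ; isCommutativeRing = record
      { isRing = record
        { +-isAbelianGroup = record
          { isGroup = record
            { isMonoid = record
              { isSemigroup = record
                { isMagma = record
                  { isEquivalence = record { refl = ≈-refl ; sym = ≈-sym ; trans = ≈-trans }
                  ; ∙-cong = +-cong }
                ; assoc = λ a b c → ≐⇒≈ (+ₚ-assoc a b c) }
              ; identity = (λ a → ≈-refl) , (λ a → ≐⇒≈ (+ₚ-identityʳ a)) }
            ; inverse = (λ a → ≐⇒≈ (+ₚ-inverseˡ a)) , (λ a → ≐⇒≈ (+ₚ-inverseʳ a))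
            ; ⁻¹-cong = neg-cong }
          ; comm = λ a b → ≐⇒≈ (+ₚ-comm a b) }
        ; *-cong = *-cong
        ; *-assoc = λ a b c → ≐⇒≈ (*ₚ-assoc a b c)
        ; *-identity = (λ a → ≐⇒≈ (*ₚ-identityˡ a)) , (λ a → ≐⇒≈ (≐-trans (*ₚ-comm a (constₚ 1ℤ)) (*ₚ-identityˡ a)))
        ; distrib = (λ a b c → ≐⇒≈ (*ₚ-distribˡ a b c)) , (λ a b c → ≐⇒≈ (*ₚ-distribʳ b c a)) }
      ; *-comm = λ a b → ≐⇒≈ (*ₚ-comm a b) } }

  decideZero : (a : Poly) → Maybe ([] ≈ a)
  decideZero a = Data.Maybe.map (λ a≐[] → ≐⇒≈ (≐-sym a≐[])) (decide≐[] a)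

  open import Tactic.RingSolver.NonReflective (ACR.fromCommutativeRing polyRing decideZero) public
    using (solve; _⊜_; _⊕_; _⊗_; ⊝_)

  module ≈-Reasoning = Relation.Binary.Reasoning.Setoid (CommutativeRing.setoid polyRing)

  deriv-cong : ∀ {a b} → a ≈ b → deriv a ≈ deriv b
  deriv-cong {a} {b} a≈b = mk≈ λ i → subst Null
    (sym (trans (cong₂ _-_ (coeff-deriv a i) (coeff-deriv b i)) (factor (+ suc i) (coeff a (suc i)) (coeff b (suc i)))))
    (∣n⇒∣m*n (+ suc i) (coeffs a≈b (suc i)))
    where
    factor : ∀ k x y → k * x - k * y ≡ k * (x - y)
    factor = solve-∀

  deriv-*ₚ : ∀ a b → deriv (a *ₚ b) ≈ deriv a *ₚ b +ₚ a *ₚ deriv b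
  deriv-*ₚ []      b = ≈-refl
  deriv-*ₚ (x ∷ a) b = begin
    deriv (scale x b +ₚ (0ℤ ∷ a *ₚ b))
      ≈⟨ ≐⇒≈ (deriv-+ₚ (scale x b) (0ℤ ∷ a *ₚ b)) ⟩
    deriv (scale x b) +ₚ deriv (0ℤ ∷ a *ₚ b)
      ≈⟨ +-cong (≐⇒≈ (≐-trans (deriv-scale x b) (scale≐constₚ*ₚ x (deriv b)))) (≐⇒≈ (deriv-∷ 0ℤ (a *ₚ b))) ⟩
    constₚ x *ₚ deriv b +ₚ (a *ₚ b +ₚ Xₚ *ₚ deriv (a *ₚ b))
      ≈⟨ +-cong (≈-refl {constₚ x *ₚ deriv b}) (+-cong (≈-refl {a *ₚ b}) (*-cong (≈-refl {Xₚ}) (deriv-*ₚ a b))) ⟩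
    constₚ x *ₚ deriv b +ₚ (a *ₚ b +ₚ Xₚ *ₚ (deriv a *ₚ b +ₚ a *ₚ deriv b))
      ≈⟨ solve 6 (λ C a b a′ b′ X → (C ⊗ b′ ⊕ (a ⊗ b ⊕ X ⊗ (a′ ⊗ b ⊕ a ⊗ b′))) ⊜ ((a ⊕ X ⊗ a′) ⊗ b ⊕ (C ⊕ X ⊗ a) ⊗ b′))
           ≈-refl (constₚ x) a b (deriv a) (deriv b) Xₚ ⟩
    (a +ₚ Xₚ *ₚ deriv a) *ₚ b +ₚ (constₚ x +ₚ Xₚ *ₚ a) *ₚ deriv b
      ≈⟨ +-cong (*-congʳ b (≐⇒≈ (≐-sym (deriv-∷ x a)))) (*-congʳ (deriv b) (≐⇒≈ (≐-sym (∷≐constₚ+Xₚ*ₚ x a)))) ⟩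
    deriv (x ∷ a) *ₚ b +ₚ (x ∷ a) *ₚ deriv b
      ∎
    where open ≈-Reasoning

  null-eval : ∀ a x → NullPoly a → Null (eval a x)
  null-eval []      x na = null-0
  null-eval (y ∷ a) x na = ∣m∣n⇒∣m+n (na 0) (∣n⇒∣m*n x (null-eval a x (na ∘ suc)))

  eval-cong : ∀ {a b} x → a ≈ b → Null (eval a x - eval b x)
  eval-cong {a} {b} x a≈b = subst Null (eval-subₚ a b x) (null-eval (a -ₚ b) x (≈⇒nullPoly-ₚ a≈b))

  NullAbove : Poly → ℕ → Set
  NullAbove a k = ∀ i → k ℕ.< i → Null (coeff a i)

  Deg : Poly → ℕ → Set
  Deg a k = ¬ Null (coeff a k) × NullAbove a k

  top-coeff-*ₚ : ∀ a b k l → NullAbove a k → NullAbove b l →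
                 Null (coeff (a *ₚ b) (k ℕ.+ l) - coeff a k * coeff b l) × NullAbove (a *ₚ b) (k ℕ.+ l)
  top-coeff-*ₚ [] b k l _ _ = null-0 , λ _ _ → null-0
  top-coeff-*ₚ (x ∷ a) b zero l a≤0 b≤l =
    subst Null (sym (trans (cong (_- x * coeff b l) (coeff-∷*ₚ x a b l)) (cancel (x * coeff b l) (coeff (0ℤ ∷ a *ₚ b) l))))
               (shifted l)
    , above
    where
    cancel : ∀ u v → u + v - u ≡ v
    cancel = solve-∀
    shifted : ∀ i → Null (coeff (0ℤ ∷ a *ₚ b) i)
    shifted zero    = null-0
    shifted (suc i) = nullPoly-*ₚ a b (λ j → a≤0 (suc j) (s≤s z≤n)) i
    above : NullAbove ((x ∷ a) *ₚ b) l
    above i l<i = subst Null (sym (coeff-∷*ₚ x a b i)) (∣m∣n⇒∣m+n (∣n⇒∣m*n x (b≤l i l<i)) (shifted i))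
  top-coeff-*ₚ (x ∷ a) b (suc k) l a≤k b≤l =
    subst Null (sym (trans (cong (_- coeff a k * coeff b l) (coeff-∷*ₚ x a b (suc (k ℕ.+ l)))) (regroup x _ _ _)))
               (∣m∣n⇒∣m+n (∣n⇒∣m*n x (b≤l _ (s≤s (ℕ.m≤n+m l k)))) (proj₁ ih))
    , above
    where
    ih : Null (coeff (a *ₚ b) (k ℕ.+ l) - coeff a k * coeff b l) × NullAbove (a *ₚ b) (k ℕ.+ l)
    ih = top-coeff-*ₚ a b k l (λ i k<i → a≤k (suc i) (s≤s k<i)) b≤l
    regroup : ∀ x y z w → x * y + z - w ≡ x * y + (z - w)
    regroup = solve-∀
    above : NullAbove ((x ∷ a) *ₚ b) (suc k ℕ.+ l)
    above (suc i) (s≤s k+l<i) = subst Null (sym (coeff-∷*ₚ x a b (suc i)))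
      (∣m∣n⇒∣m+n (∣n⇒∣m*n x (b≤l (suc i) (s≤s (ℕ.≤-trans (ℕ.m≤n+m l k) (ℕ.<⇒≤ k+l<i))))) (proj₂ ih i k+l<i))

  null-or-deg : ∀ a → NullPoly a ⊎ ∃ (Deg a)
  null-or-deg []      = inj₁ λ _ → null-0
  null-or-deg (x ∷ a) with null-or-deg a
  ... | inj₂ (k , a[k]≢0 , a≤k) = inj₂ (suc k , a[k]≢0 , λ { (suc i) (s≤s k<i) → a≤k i k<i })
  ... | inj₁ null-a with + n ∣? x
  ...   | yes null-x = inj₁ λ { zero → null-x ; (suc i) → null-a i }
  ...   | no ¬null-x = inj₂ (0 , ¬null-x , λ { (suc i) _ → null-a i })

  factor-theorem : ∀ r q → q ≈ X- r *ₚ quot r q +ₚ constₚ (eval q r)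
  factor-theorem r []      = ≐⇒≈ (coeffwise λ { zero → refl ; (suc zero) → refl ; (suc (suc i)) → refl })
  factor-theorem r (a ∷ q) = begin
    a ∷ q
      ≈⟨ ≐⇒≈ (∷≐constₚ+Xₚ*ₚ a q) ⟩
    constₚ a +ₚ Xₚ *ₚ q
      ≈⟨ +-cong (≈-refl {constₚ a}) (*-cong (≐⇒≈ (Xₚ≐X-+constₚ r)) (factor-theorem r q)) ⟩
    constₚ a +ₚ (X- r +ₚ constₚ r) *ₚ (X- r *ₚ quot r q +ₚ constₚ s)
      ≈⟨ solve 5 (λ A R S Y C → (A ⊕ (Y ⊕ R) ⊗ (Y ⊗ S ⊕ C)) ⊜ (Y ⊗ (C ⊕ (Y ⊕ R) ⊗ S) ⊕ (A ⊕ R ⊗ C)))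
           ≈-refl (constₚ a) (constₚ r) (quot r q) (X- r) (constₚ s) ⟩
    X- r *ₚ (constₚ s +ₚ (X- r +ₚ constₚ r) *ₚ quot r q) +ₚ (constₚ a +ₚ constₚ r *ₚ constₚ s)
      ≈⟨ +-cong (*-cong (≈-refl {X- r}) (+-cong (≈-refl {constₚ s}) (*-congʳ (quot r q) (≐⇒≈ (≐-sym (Xₚ≐X-+constₚ r))))))
                (+-cong (≈-refl {constₚ a}) (≐⇒≈ (constₚ-*ₚ r s))) ⟩
    X- r *ₚ (constₚ s +ₚ Xₚ *ₚ quot r q) +ₚ constₚ (a + r * s)
      ≈⟨ +-cong (*-cong (≈-refl {X- r}) (≐⇒≈ (≐-sym (∷≐constₚ+Xₚ*ₚ s (quot r q))))) ≈-refl ⟩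
    X- r *ₚ quot r (a ∷ q) +ₚ constₚ (eval (a ∷ q) r)
      ∎
    where
    open ≈-Reasoning
    s : ℤ
    s = eval q r

  root⇒X-∣ : ∀ {r} q → Null (eval q r) → q ≈ X- r *ₚ quot r q
  root⇒X-∣ {r} q null-q[r] = begin
    q                                              ≈⟨ factor-theorem r q ⟩
    X- r *ₚ quot r q +ₚ constₚ (eval q r)
      ≈⟨ +-cong ≈-refl (nullPoly⇒≈[] λ { zero → null-q[r] ; (suc i) → null-0 }) ⟩
    X- r *ₚ quot r q +ₚ []                         ≈⟨ ≐⇒≈ (+ₚ-identityʳ _) ⟩
    X- r *ₚ quot r q                               ∎
    where open ≈-Reasoning

  eval-root : ∀ {r c} a b → a *ₚ b ≈ X- r *ₚ c → Null (eval a r * eval b r)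
  eval-root {r} {c} a b ab≈ = subst Null eq (eval-cong r ab≈)
    where
    eq : eval (a *ₚ b) r - eval (X- r *ₚ c) r ≡ eval a r * eval b r
    eq = begin
      eval (a *ₚ b) r - eval (X- r *ₚ c) r           ≡⟨ cong₂ _-_ (eval-*ₚ a b r) (eval-*ₚ (X- r) c r) ⟩
      eval a r * eval b r - eval (X- r) r * eval c r ≡⟨ cong (λ z → eval a r * eval b r - z * eval c r) (eval-X- r) ⟩
      eval a r * eval b r - 0ℤ                       ≡⟨ ℤ.+-identityʳ _ ⟩
      eval a r * eval b r                            ∎
      where open ≡-Reasoning

  ≈⇒ZeroMod : ∀ {a b} → a ≈ b → ZeroMod n (a -ₚ b)
  ≈⇒ZeroMod a≈b i = ∣⇒∣ᵤ (≈⇒nullPoly-ₚ a≈b i)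

  ZeroMod⇒≈ : ∀ {a b} → ZeroMod n (a -ₚ b) → a ≈ b
  ZeroMod⇒≈ zero-a-b = nullPoly-ₚ⇒≈ (∣ᵤ⇒∣ ∘ zero-a-b)

  Deg⇒HasDegMod : ∀ a {k} → Deg a k → HasDegMod n a k
  Deg⇒HasDegMod a (¬null-top , above) = ¬null-top ∘ ∣ᵤ⇒∣ , λ i k<i → ∣⇒∣ᵤ (above i k<i)

  ¬null-eval-factor : ∀ {a} g h x → a ≈ g *ₚ h → ¬ Null (eval a x) → ¬ Null (eval g x)
  ¬null-eval-factor {a} g h x a≈gh ¬null-a[x] null-g[x] =
    ¬null-a[x] (null-≈ˡ (eval-cong x a≈gh) (subst Null (sym (eval-*ₚ g h x)) (∣m⇒∣m*n (eval h x) null-g[x])))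

-- The hypotheses say that ℤ/n is an integral domain, i.e. n is 0 or a prime.
module Domain (n : ℕ) (nontrivial : ¬ Modulo.Null n 1ℤ)
              (euclid : ∀ {x y} → Modulo.Null n (x * y) → Modulo.Null n x ⊎ Modulo.Null n y) where
  open Modulo n

  deg-*ₚ : ∀ {a b k l} → Deg a k → Deg b l → Deg (a *ₚ b) (k ℕ.+ l)
  deg-*ₚ {a} {b} {k} {l} (a[k]≢0 , a≤k) (b[l]≢0 , b≤l) with top-coeff-*ₚ a b k l a≤k b≤l
  ... | top , above = (λ null-top → [ a[k]≢0 , b[l]≢0 ]′ (euclid (null-≈ʳ top null-top))) , above

  nullPoly-*ₚ⁻ : ∀ a b → NullPoly (a *ₚ b) → NullPoly a ⊎ NullPoly b
  nullPoly-*ₚ⁻ a b null-ab with null-or-deg a | null-or-deg b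
  ... | inj₁ null-a     | _             = inj₁ null-a
  ... | inj₂ _          | inj₁ null-b    = inj₂ null-b
  ... | inj₂ (k , a≡k) | inj₂ (l , b≡l) = ⊥-elim (proj₁ (deg-*ₚ {a} {b} a≡k b≡l) (null-ab (k ℕ.+ l)))

  *-cancelˡ : ∀ a {b c} → ¬ NullPoly a → a *ₚ b ≈ a *ₚ c → b ≈ c
  *-cancelˡ a {b} {c} ¬null-a ab≈ac =
    [ (λ null-a → ⊥-elim (¬null-a null-a)) , nullPoly-ₚ⇒≈ ]′
      (nullPoly-*ₚ⁻ a (b -ₚ c) (nullPoly-resp (factor a b c) (≈⇒nullPoly-ₚ ab≈ac)))
    where
    factor : ∀ a b c → a *ₚ b -ₚ a *ₚ c ≈ a *ₚ (b -ₚ c)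
    factor = solve 3 (λ a b c → (a ⊗ b ⊕ ⊝ (a ⊗ c)) ⊜ (a ⊗ (b ⊕ ⊝ c))) ≈-refl

  ¬null-* : ∀ {x y} → ¬ Null x → ¬ Null y → ¬ Null (x * y)
  ¬null-* ¬null-x ¬null-y null-xy = [ ¬null-x , ¬null-y ]′ (euclid null-xy)

  X-≢0 : ∀ r → ¬ NullPoly (X- r)
  X-≢0 r null = nontrivial (null 1)

  X-^≢0 : ∀ r k → ¬ NullPoly ((X- r) ^ₚ k)
  X-^≢0 r zero    null = nontrivial (null 0)
  X-^≢0 r (suc k) null = [ X-≢0 r , X-^≢0 r k ]′ (nullPoly-*ₚ⁻ (X- r) ((X- r) ^ₚ k) null)

  unit⇒deg0 : ∀ a b {w} → a *ₚ b ≈ constₚ w → ¬ Null w → Deg a 0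
  unit⇒deg0 a b ab≈w ¬null-w with null-or-deg a | null-or-deg b
  ... | inj₁ null-a | _ = ⊥-elim (¬null-w (null-≈ʳ (coeffs ab≈w 0) (nullPoly-*ₚ a b null-a 0)))
  ... | inj₂ _ | inj₁ null-b =
    ⊥-elim (¬null-w (null-≈ʳ (coeffs ab≈w 0) (nullPoly-resp (≐⇒≈ (*ₚ-comm b a)) (nullPoly-*ₚ b a null-b) 0)))
  ... | inj₂ (zero , a≡0) | inj₂ _ = a≡0
  ... | inj₂ (suc k , a≡k) | inj₂ (l , b≡l) =
    ⊥-elim (proj₁ (deg-*ₚ {a} {b} a≡k b≡l) (null-≈ˡ (coeffs ab≈w (suc k ℕ.+ l)) null-0))

  -- As g(r) ≠ 0, the equation forces q(r) = 0, so X − r divides q and one factor cancels.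
  peel-X- : ∀ g r → ¬ Null (eval g r) → ∀ k q {s} → g *ₚ q ≈ (X- r) ^ₚ k *ₚ s → ∃ λ q′ → g *ₚ q′ ≈ s
  peel-X- g r ¬null-g[r] zero    q {s} gq≈s = q , ≈-trans gq≈s (≐⇒≈ (*ₚ-identityˡ s))
  peel-X- g r ¬null-g[r] (suc k) q {s} gq≈ =
    peel-X- g r ¬null-g[r] k (quot r q) (*-cancelˡ (X- r) (X-≢0 r) (≈-trans shuffle gq≈′))
    where
    gq≈′ : g *ₚ q ≈ X- r *ₚ ((X- r) ^ₚ k *ₚ s)
    gq≈′ = ≈-trans gq≈ (≐⇒≈ (*ₚ-assoc (X- r) ((X- r) ^ₚ k) s))
    null-q[r] : Null (eval q r)
    null-q[r] = [ ⊥-elim ∘ ¬null-g[r] , id ]′ (euclid (eval-root g q gq≈′))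
    swap : ∀ x g q → x *ₚ (g *ₚ q) ≈ g *ₚ (x *ₚ q)
    swap = solve 3 (λ x g q → (x ⊗ (g ⊗ q)) ⊜ (g ⊗ (x ⊗ q))) ≈-refl
    shuffle : X- r *ₚ (g *ₚ quot r q) ≈ g *ₚ q
    shuffle = ≈-trans (swap (X- r) g (quot r q)) (*-cong (≈-refl {g}) (≈-sym (root⇒X-∣ q null-q[r])))

module Wronskian (n : ℕ) where
  open Modulo n

  wronski-cong : ∀ {f₁ f₂ g₁ g₂} → f₁ ≈ g₁ → f₂ ≈ g₂ → wronski f₁ f₂ ≈ wronski g₁ g₂
  wronski-cong f₁≈g₁ f₂≈g₂ = +-cong (*-cong (deriv-cong f₁≈g₁) f₂≈g₂) (neg-cong (*-cong f₁≈g₁ (deriv-cong f₂≈g₂)))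

  wronski-scale : ∀ c₁ c₂ g₁ g₂ → wronski (scale c₁ g₁) (scale c₂ g₂) ≈ constₚ (c₁ * c₂) *ₚ wronski g₁ g₂
  wronski-scale c₁ c₂ g₁ g₂ = begin
    deriv (scale c₁ g₁) *ₚ scale c₂ g₂ -ₚ scale c₁ g₁ *ₚ deriv (scale c₂ g₂)
      ≈⟨ +-cong (*-cong (deriv-scale≈ c₁ g₁) (scale≈ c₂ g₂)) (neg-cong (*-cong (scale≈ c₁ g₁) (deriv-scale≈ c₂ g₂))) ⟩
    (C₁ *ₚ deriv g₁) *ₚ (C₂ *ₚ g₂) -ₚ (C₁ *ₚ g₁) *ₚ (C₂ *ₚ deriv g₂)
      ≈⟨ solve 6 (λ C₁ C₂ g₁ g₂ g₁′ g₂′ → ((C₁ ⊗ g₁′) ⊗ (C₂ ⊗ g₂) ⊕ ⊝ ((C₁ ⊗ g₁) ⊗ (C₂ ⊗ g₂′)))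
                                           ⊜ ((C₁ ⊗ C₂) ⊗ (g₁′ ⊗ g₂ ⊕ ⊝ (g₁ ⊗ g₂′))))
           ≈-refl C₁ C₂ g₁ g₂ (deriv g₁) (deriv g₂) ⟩
    (C₁ *ₚ C₂) *ₚ wronski g₁ g₂
      ≈⟨ *-congʳ (wronski g₁ g₂) (≐⇒≈ (constₚ-*ₚ c₁ c₂)) ⟩
    constₚ (c₁ * c₂) *ₚ wronski g₁ g₂ ∎
    where
    open ≈-Reasoning
    C₁ C₂ : Poly
    C₁ = constₚ c₁
    C₂ = constₚ c₂
    scale≈ : ∀ c g → scale c g ≈ constₚ c *ₚ g
    scale≈ c g = ≐⇒≈ (scale≐constₚ*ₚ c g)
    deriv-scale≈ : ∀ c g → deriv (scale c g) ≈ constₚ c *ₚ deriv g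
    deriv-scale≈ c g = ≐⇒≈ (≐-trans (deriv-scale c g) (scale≐constₚ*ₚ c (deriv g)))

  wronski-common-factor : ∀ g q₁ q₂ →
    wronski (g *ₚ q₁) (g *ₚ q₂) ≈ g *ₚ (deriv (g *ₚ q₁) *ₚ q₂ -ₚ q₁ *ₚ deriv (g *ₚ q₂))
  wronski-common-factor g q₁ q₂ =
    solve 5 (λ g q₁ q₂ D₁ D₂ → (D₁ ⊗ (g ⊗ q₂) ⊕ ⊝ ((g ⊗ q₁) ⊗ D₂)) ⊜ (g ⊗ (D₁ ⊗ q₂ ⊕ ⊝ (q₁ ⊗ D₂))))
      ≈-refl g q₁ q₂ (deriv (g *ₚ q₁)) (deriv (g *ₚ q₂))

  wronski-+ₚ-diagonal : ∀ h f → wronski (h +ₚ f) f ≈ wronski h f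
  wronski-+ₚ-diagonal h f = ≈-trans
    (+-cong (*-congʳ f (≐⇒≈ (deriv-+ₚ h f))) ≈-refl)
    (solve 4 (λ h f h′ f′ → ((h′ ⊕ f′) ⊗ f ⊕ ⊝ ((h ⊕ f) ⊗ f′)) ⊜ (h′ ⊗ f ⊕ ⊝ (h ⊗ f′))) ≈-refl h f (deriv h) (deriv f))

  deriv-X-^ : ∀ r b → deriv ((X- r) ^ₚ suc b) ≈ constₚ (+ suc b) *ₚ (X- r) ^ₚ b
  deriv-X-^ r zero    = ≈-refl
  deriv-X-^ r (suc b) = begin
    deriv (X- r *ₚ V)
      ≈⟨ deriv-*ₚ (X- r) V ⟩
    constₚ 1ℤ *ₚ V +ₚ X- r *ₚ deriv V
      ≈⟨ +-cong (≈-refl {constₚ 1ℤ *ₚ V}) (*-cong (≈-refl {X- r}) (deriv-X-^ r b)) ⟩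
    constₚ 1ℤ *ₚ V +ₚ X- r *ₚ (constₚ (+ suc b) *ₚ (X- r) ^ₚ b)
      ≈⟨ solve 4 (λ O Y C W → (O ⊗ (Y ⊗ W) ⊕ Y ⊗ (C ⊗ W)) ⊜ ((O ⊕ C) ⊗ (Y ⊗ W))) ≈-refl
           (constₚ 1ℤ) (X- r) (constₚ (+ suc b)) ((X- r) ^ₚ b) ⟩
    constₚ (+ suc (suc b)) *ₚ V ∎
    where
    open ≈-Reasoning
    V : Poly
    V = (X- r) ^ₚ suc b

  wronski-X-^-multiple : ∀ r b q f →
    wronski ((X- r) ^ₚ suc b *ₚ q) f ≈ (X- r) ^ₚ b *ₚ (constₚ (+ suc b) *ₚ q *ₚ f +ₚ X- r *ₚ wronski q f)
  wronski-X-^-multiple r b q f = begin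
    deriv (Y *ₚ V *ₚ q) *ₚ f -ₚ Y *ₚ V *ₚ q *ₚ deriv f
      ≈⟨ +-cong (*-congʳ f (deriv-*ₚ (Y *ₚ V) q)) ≈-refl ⟩
    (deriv (Y *ₚ V) *ₚ q +ₚ Y *ₚ V *ₚ deriv q) *ₚ f -ₚ Y *ₚ V *ₚ q *ₚ deriv f
      ≈⟨ +-cong (*-congʳ f (+-cong (*-congʳ q (deriv-X-^ r b)) ≈-refl)) ≈-refl ⟩
    (C *ₚ V *ₚ q +ₚ Y *ₚ V *ₚ deriv q) *ₚ f -ₚ Y *ₚ V *ₚ q *ₚ deriv f
      ≈⟨ solve 7 (λ C V q q′ Y f f′ → ((C ⊗ V ⊗ q ⊕ Y ⊗ V ⊗ q′) ⊗ f ⊕ ⊝ (Y ⊗ V ⊗ q ⊗ f′))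
                                     ⊜ (V ⊗ (C ⊗ q ⊗ f ⊕ Y ⊗ (q′ ⊗ f ⊕ ⊝ (q ⊗ f′)))))
           ≈-refl C V q (deriv q) Y f (deriv f) ⟩
    V *ₚ (C *ₚ q *ₚ f +ₚ Y *ₚ wronski q f) ∎
    where
    open ≈-Reasoning
    Y V C : Poly
    Y = X- r
    V = (X- r) ^ₚ b
    C = constₚ (+ suc b)

Deg≤ : Poly → ℕ → Set
Deg≤ a k = ∀ i → k ℕ.< i → coeff a i ≡ 0ℤ

Ord≥ : Poly → ℕ → Set
Ord≥ a k = ∀ i → i ℕ.< k → coeff a i ≡ 0ℤ

private module Exact = Modulo 0

null₀-⇒≡ : ∀ {x y} → Exact.Null (x - y) → x ≡ y
null₀-⇒≡ {x} {y} null = ℤ.i-j≡0⇒i≡j x y (0∣⇒≡0 null)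

≈₀⇒≐ : ∀ {a b} → a Exact.≈ b → a ≐ b
≈₀⇒≐ a≈b = coeffwise λ i → null₀-⇒≡ (Exact.coeffs a≈b i)

coeff-*ₚ-top : ∀ a b k l → Deg≤ a k → Deg≤ b l →
               coeff (a *ₚ b) (k ℕ.+ l) ≡ coeff a k * coeff b l × Deg≤ (a *ₚ b) (k ℕ.+ l)
coeff-*ₚ-top a b k l a≤k b≤l =
  let top , above = Exact.top-coeff-*ₚ a b k l (λ i k<i → Exact.≡0⇒null (a≤k i k<i)) (λ i l<i → Exact.≡0⇒null (b≤l i l<i))
  in null₀-⇒≡ top , λ i k+l<i → 0∣⇒≡0 (above i k+l<i)

coeff-*ₚ-bottom : ∀ a b k → Ord≥ a k → coeff (a *ₚ b) k ≡ coeff a k * coeff b 0 × Ord≥ (a *ₚ b) k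
coeff-*ₚ-bottom []      b k       _    = sym (ℤ.*-zeroˡ (coeff b 0)) , λ _ _ → refl
coeff-*ₚ-bottom (x ∷ a) b zero    _    = trans (coeff-∷*ₚ x a b 0) (ℤ.+-identityʳ _) , λ _ ()
coeff-*ₚ-bottom (x ∷ a) b (suc k) a≥k = ih′ , below
  where
  x≡0 : x ≡ 0ℤ
  x≡0 = a≥k 0 (s≤s z≤n)
  ih : coeff (a *ₚ b) k ≡ coeff a k * coeff b 0 × Ord≥ (a *ₚ b) k
  ih = coeff-*ₚ-bottom a b k (λ i i<k → a≥k (suc i) (s≤s i<k))
  drop-x : ∀ i → coeff ((x ∷ a) *ₚ b) i ≡ coeff (0ℤ ∷ a *ₚ b) i
  drop-x i = trans (coeff-∷*ₚ x a b i) (trans (cong (λ y → y * coeff b i + _) x≡0) (ℤ.+-identityˡ _))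
  ih′ : coeff ((x ∷ a) *ₚ b) (suc k) ≡ coeff a k * coeff b 0
  ih′ = trans (drop-x (suc k)) (proj₁ ih)
  below : Ord≥ ((x ∷ a) *ₚ b) (suc k)
  below zero    _         = drop-x 0
  below (suc i) (s≤s i<k) = trans (drop-x (suc i)) (proj₂ ih i i<k)

deriv-Deg≤ : ∀ a k → Deg≤ a (suc k) → Deg≤ (deriv a) k
deriv-Deg≤ a k a≤k i k<i =
  trans (coeff-deriv a i) (trans (cong (+ suc i *_) (a≤k (suc i) (s≤s k<i))) (ℤ.*-zeroʳ (+ suc i)))

deriv-Ord≥ : ∀ a k → Ord≥ a (suc k) → Ord≥ (deriv a) k
deriv-Ord≥ a k a≥k i i<k =
  trans (coeff-deriv a i) (trans (cong (+ suc i *_) (a≥k (suc i) (s≤s i<k))) (ℤ.*-zeroʳ (+ suc i)))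

coeff-wronski-top : ∀ g₁ g₂ k m → Deg≤ g₁ (suc k) → Deg≤ g₂ m →
  coeff (wronski g₁ g₂) (k ℕ.+ m) ≡ (+ suc k - + m) * (coeff g₁ (suc k) * coeff g₂ m)
coeff-wronski-top g₁ g₂ k m g₁≤k g₂≤m = begin
  coeff (wronski g₁ g₂) (k ℕ.+ m)
    ≡⟨ coeff-subₚ (deriv g₁ *ₚ g₂) (g₁ *ₚ deriv g₂) (k ℕ.+ m) ⟩
  coeff (deriv g₁ *ₚ g₂) (k ℕ.+ m) - coeff (g₁ *ₚ deriv g₂) (k ℕ.+ m)
    ≡⟨ cong₂ _-_ (trans (proj₁ (coeff-*ₚ-top (deriv g₁) g₂ k m (deriv-Deg≤ g₁ k g₁≤k) g₂≤m))
                        (cong (_* coeff g₂ m) (coeff-deriv g₁ k)))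
                 (leading m g₂≤m) ⟩
  + suc k * coeff g₁ (suc k) * coeff g₂ m - + m * (coeff g₁ (suc k) * coeff g₂ m)
    ≡⟨ factor (+ suc k) (+ m) (coeff g₁ (suc k)) (coeff g₂ m) ⟩
  (+ suc k - + m) * (coeff g₁ (suc k) * coeff g₂ m) ∎
  where
  open ≡-Reasoning
  factor : ∀ x y u v → x * u * v - y * (u * v) ≡ (x - y) * (u * v)
  factor = solve-∀
  reorder : ∀ x u v → u * (x * v) ≡ x * (u * v)
  reorder = solve-∀
  leading : ∀ m → Deg≤ g₂ m → coeff (g₁ *ₚ deriv g₂) (k ℕ.+ m) ≡ + m * (coeff g₁ (suc k) * coeff g₂ m)
  leading zero    g₂≤0 = 0∣⇒≡0 (Exact.nullPoly-resp (Exact.≐⇒≈ (*ₚ-comm (deriv g₂) g₁))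
                           (Exact.nullPoly-*ₚ (deriv g₂) g₁ (λ i → Exact.≡0⇒null (deriv-vanishes i))) (k ℕ.+ 0))
    where
    deriv-vanishes : ∀ i → coeff (deriv g₂) i ≡ 0ℤ
    deriv-vanishes i = trans (coeff-deriv g₂ i) (trans (cong (+ suc i *_) (g₂≤0 (suc i) (s≤s z≤n))) (ℤ.*-zeroʳ (+ suc i)))
  leading (suc m) g₂≤m = begin
    coeff (g₁ *ₚ deriv g₂) (k ℕ.+ suc m)        ≡⟨ cong (coeff (g₁ *ₚ deriv g₂)) (ℕ.+-suc k m) ⟩
    coeff (g₁ *ₚ deriv g₂) (suc k ℕ.+ m)
      ≡⟨ proj₁ (coeff-*ₚ-top g₁ (deriv g₂) (suc k) m g₁≤k (deriv-Deg≤ g₂ m g₂≤m)) ⟩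
    coeff g₁ (suc k) * coeff (deriv g₂) m       ≡⟨ cong (coeff g₁ (suc k) *_) (coeff-deriv g₂ m) ⟩
    coeff g₁ (suc k) * (+ suc m * coeff g₂ (suc m)) ≡⟨ reorder (+ suc m) (coeff g₁ (suc k)) (coeff g₂ (suc m)) ⟩
    + suc m * (coeff g₁ (suc k) * coeff g₂ (suc m)) ∎

coeff-wronski-bottom : ∀ g₁ g₂ a → Ord≥ g₁ (suc a) →
  coeff (wronski g₁ g₂) a ≡ + suc a * coeff g₁ (suc a) * coeff g₂ 0
coeff-wronski-bottom g₁ g₂ a g₁≥a = begin
  coeff (wronski g₁ g₂) a
    ≡⟨ coeff-subₚ (deriv g₁ *ₚ g₂) (g₁ *ₚ deriv g₂) a ⟩
  coeff (deriv g₁ *ₚ g₂) a - coeff (g₁ *ₚ deriv g₂) a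
    ≡⟨ cong₂ _-_ (proj₁ (coeff-*ₚ-bottom (deriv g₁) g₂ a (deriv-Ord≥ g₁ a g₁≥a)))
                 (proj₂ (coeff-*ₚ-bottom g₁ (deriv g₂) (suc a) g₁≥a) a (ℕ.n<1+n a)) ⟩
  coeff (deriv g₁) a * coeff g₂ 0 - 0ℤ
    ≡⟨ ℤ.+-identityʳ _ ⟩
  coeff (deriv g₁) a * coeff g₂ 0
    ≡⟨ cong (_* coeff g₂ 0) (coeff-deriv g₁ a) ⟩
  + suc a * coeff g₁ (suc a) * coeff g₂ 0 ∎
  where open ≡-Reasoning

coeff-Xₚ^-*ₚ : ∀ k a i → coeff (Xₚ ^ₚ k *ₚ a) (k ℕ.+ i) ≡ coeff a i
coeff-Xₚ^-*ₚ zero    a i = coeff-≡ (*ₚ-identityˡ a) i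
coeff-Xₚ^-*ₚ (suc k) a i = begin
  coeff ((Xₚ *ₚ Xₚ ^ₚ k) *ₚ a) (suc k ℕ.+ i) ≡⟨ coeff-≡ (*ₚ-assoc Xₚ (Xₚ ^ₚ k) a) (suc k ℕ.+ i) ⟩
  coeff (Xₚ *ₚ (Xₚ ^ₚ k *ₚ a)) (suc k ℕ.+ i) ≡⟨ coeff-≡ (Xₚ-*ₚ (Xₚ ^ₚ k *ₚ a)) (suc k ℕ.+ i) ⟩
  coeff (Xₚ ^ₚ k *ₚ a) (k ℕ.+ i)             ≡⟨ coeff-Xₚ^-*ₚ k a i ⟩
  coeff a i                                  ∎
  where open ≡-Reasoning

coeff-X-^-top : ∀ r b → coeff ((X- r) ^ₚ b) b ≡ 1ℤ × Deg≤ ((X- r) ^ₚ b) b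
coeff-X-^-top r zero    = refl , λ { (suc j) _ → refl }
coeff-X-^-top r (suc b) =
  let top , above = coeff-*ₚ-top (X- r) ((X- r) ^ₚ b) 1 b X-r≤1 (proj₂ ih)
  in trans top (trans (cong (1ℤ *_) (proj₁ ih)) refl) , above
  where
  ih : coeff ((X- r) ^ₚ b) b ≡ 1ℤ × Deg≤ ((X- r) ^ₚ b) b
  ih = coeff-X-^-top r b
  X-r≤1 : Deg≤ (X- r) 1
  X-r≤1 (suc (suc i)) _         = refl
  X-r≤1 (suc zero)    (s≤s ())

eval-constₚ : ∀ c x → eval (constₚ c) x ≡ c
eval-constₚ c x = trans (cong (_+_ c) (ℤ.*-zeroʳ x)) (ℤ.+-identityʳ c)

eval-^ₚ : ∀ a k x → eval (a ^ₚ k) x ≡ eval a x ^ k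
eval-^ₚ a zero    x = eval-constₚ 1ℤ x
eval-^ₚ a (suc k) x = trans (eval-*ₚ a (a ^ₚ k) x) (cong (eval a x *_) (eval-^ₚ a k x))

eval-0 : ∀ a → eval a 0ℤ ≡ coeff a 0
eval-0 []      = refl
eval-0 (x ∷ a) = ℤ.+-identityʳ x

prime⇒¬null-1 : ∀ {p} → Prime p → ¬ Modulo.Null p 1ℤ
prime⇒¬null-1 p-prime p∣1 = ¬prime[1] (subst Prime (∣1⇒≡1 (∣⇒∣ᵤ p∣1)) p-prime)

prime⇒euclid : ∀ {p} → Prime p → ∀ {x y} → Modulo.Null p (x * y) → Modulo.Null p x ⊎ Modulo.Null p y
prime⇒euclid {p} p-prime {x} {y} p∣xy =
  Data.Sum.map ∣ᵤ⇒∣ ∣ᵤ⇒∣ (euclidsLemma ℤ.∣ x ∣ ℤ.∣ y ∣ p-prime (subst (p ∣_) (ℤ.abs-* x y) (∣⇒∣ᵤ p∣xy)))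

module ModPrime {p} (p-prime : Prime p) = Domain p (prime⇒¬null-1 p-prime) (prime⇒euclid p-prime)

ℤ-nontrivial : ¬ Exact.Null 1ℤ
ℤ-nontrivial 0∣1 = case 0∣⇒≡0 0∣1 of λ ()

ℤ-euclid : ∀ {x y} → Exact.Null (x * y) → Exact.Null x ⊎ Exact.Null y
ℤ-euclid {x} 0∣xy = Data.Sum.map Exact.≡0⇒null Exact.≡0⇒null (ℤ.i*j≡0⇒i≡0∨j≡0 x (0∣⇒≡0 0∣xy))

module ModZero = Domain 0 ℤ-nontrivial ℤ-euclid

-1^-square : ∀ k → -1ℤ ^ k * -1ℤ ^ k ≡ 1ℤ
-1^-square zero    = refl
-1^-square (suc k) = trans (square (-1ℤ ^ k)) (-1^-square k)
  where
  square : ∀ u → -1ℤ * u * (-1ℤ * u) ≡ u * u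
  square = solve-∀

≈ₚ⇒≐ : ∀ a b → a ≈ₚ b → a ≐ b
≈ₚ⇒≐ a b a-b≡0 = coeffwise λ i → ℤ.i-j≡0⇒i≡j _ _ (trans (sym (coeff-subₚ a b i)) (a-b≡0 i))

constₚ-∣ₚ-scale : ∀ {x c} f g → f ≐ scale c g → x ∣ℤ c → constₚ x ∣ₚ f
constₚ-∣ₚ-scale {x} {c} f g f≐cg (divides k c≡kx) = scale k g , λ i → begin
  coeff (f -ₚ constₚ x *ₚ scale k g) i
    ≡⟨ coeff-subₚ f (constₚ x *ₚ scale k g) i ⟩
  coeff f i - coeff (constₚ x *ₚ scale k g) i
    ≡⟨ cong₂ _-_ (trans (coeff-≡ f≐cg i) (coeff-scale c g i))
                 (trans (sym (coeff-≡ (scale≐constₚ*ₚ x (scale k g)) i))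
                        (trans (coeff-scale x (scale k g) i) (cong (x *_) (coeff-scale k g i)))) ⟩
  c * coeff g i - x * (k * coeff g i)
    ≡⟨ cong (λ c → c * coeff g i - x * (k * coeff g i)) c≡kx ⟩
  k * x * coeff g i - x * (k * coeff g i)
    ≡⟨ cancel k x (coeff g i) ⟩
  0ℤ ∎
  where
  open ≡-Reasoning
  cancel : ∀ k x y → k * x * y - x * (k * y) ≡ 0ℤ
  cancel = solve-∀

i*j≡0⇒j≡0 : ∀ {i j} → i ≢ 0ℤ → i * j ≡ 0ℤ → j ≡ 0ℤ
i*j≡0⇒j≡0 {i} i≢0 ij≡0 = [ ⊥-elim ∘ i≢0 , id ]′ (ℤ.i*j≡0⇒i≡0∨j≡0 i ij≡0)

-- Here e₁ = a + 1, e₂ = b + 1 and d = d′ + 1, and m bounds the degree of f₂.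
module Reduction
  {d′ a b e₃ : ℕ} {f₁ f₂ : Poly} (belyi : IsNormBelyi (suc d′) (suc a) (suc b) e₃ f₁ f₂)
  {c₁ c₂ : ℤ} {g₁ g₂ : Poly} (c₁≢0 : c₁ ≢ 0ℤ) (c₂≢0 : c₂ ≢ 0ℤ)
  (f₁≈c₁g₁ : f₁ ≈ₚ scale c₁ g₁) (f₂≈c₂g₂ : f₂ ≈ₚ scale c₂ g₂) where

  open IsNormBelyi belyi

  d m : ℕ
  d = suc d′
  m = d ∸ e₃

  P : Poly
  P = Xₚ ^ₚ a *ₚ X-1ₚ ^ₚ b

  c w : ℤ
  c = proj₁ unram
  w = + e₃ * (coeff g₁ d * coeff g₂ m)

  m+e₃≡d : m ℕ.+ e₃ ≡ d
  m+e₃≡d = ℕ.m∸n+n≡m (proj₂ e₃-range)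

  top-index : a ℕ.+ b ≡ d′ ℕ.+ m
  top-index = ℕ.+-cancelʳ-≡ (suc (suc e₃)) (a ℕ.+ b) (d′ ℕ.+ m) (begin
    a ℕ.+ b ℕ.+ suc (suc e₃)  ≡⟨ shift a b e₃ ⟩
    suc a ℕ.+ suc b ℕ.+ e₃    ≡⟨ e-sum ⟩
    2 ℕ.* d ℕ.+ 1             ≡⟨ double d′ ⟩
    d′ ℕ.+ d ℕ.+ 2            ≡⟨ cong (λ t → d′ ℕ.+ t ℕ.+ 2) m+e₃≡d ⟨
    d′ ℕ.+ (m ℕ.+ e₃) ℕ.+ 2   ≡⟨ regroup d′ m e₃ ⟩
    d′ ℕ.+ m ℕ.+ suc (suc e₃) ∎)
    where
    open ≡-Reasoning
    shift : ∀ a b e → a ℕ.+ b ℕ.+ suc (suc e) ≡ suc a ℕ.+ suc b ℕ.+ e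
    shift = ℕ-solve-∀
    double : ∀ d′ → 2 ℕ.* suc d′ ℕ.+ 1 ≡ d′ ℕ.+ suc d′ ℕ.+ 2
    double = ℕ-solve-∀
    regroup : ∀ d′ m e → d′ ℕ.+ (m ℕ.+ e) ℕ.+ 2 ≡ d′ ℕ.+ m ℕ.+ suc (suc e)
    regroup = ℕ-solve-∀

  coeff-f₁ : ∀ i → coeff f₁ i ≡ c₁ * coeff g₁ i
  coeff-f₁ i = trans (coeff-≡ (≈ₚ⇒≐ f₁ (scale c₁ g₁) f₁≈c₁g₁) i) (coeff-scale c₁ g₁ i)

  coeff-f₂ : ∀ i → coeff f₂ i ≡ c₂ * coeff g₂ i
  coeff-f₂ i = trans (coeff-≡ (≈ₚ⇒≐ f₂ (scale c₂ g₂) f₂≈c₂g₂) i) (coeff-scale c₂ g₂ i)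

  g₁≤d : Deg≤ g₁ d
  g₁≤d i d<i = i*j≡0⇒j≡0 c₁≢0 (trans (sym (coeff-f₁ i)) (proj₂ deg-f₁ i d<i))

  g₂≤m : Deg≤ g₂ m
  g₂≤m i m<i = i*j≡0⇒j≡0 c₂≢0 (trans (sym (coeff-f₂ i)) (proj₂ deg-f₂ i m<i))

  g₁≥e₁ : Ord≥ g₁ (suc a)
  g₁≥e₁ i i<e₁ = i*j≡0⇒j≡0 c₁≢0 (trans (sym (coeff-f₁ i)) (proj₁ ram-0 i i<e₁))

  private module W₀ = Wronskian 0

  f₁≈₀ : f₁ Exact.≈ scale c₁ g₁
  f₁≈₀ = Exact.≐⇒≈ (≈ₚ⇒≐ f₁ (scale c₁ g₁) f₁≈c₁g₁)

  f₂≈₀ : f₂ Exact.≈ scale c₂ g₂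
  f₂≈₀ = Exact.≐⇒≈ (≈ₚ⇒≐ f₂ (scale c₂ g₂) f₂≈c₂g₂)

  coeff-wronski-f : ∀ i → coeff (wronski f₁ f₂) i ≡ c₁ * c₂ * coeff (wronski g₁ g₂) i
  coeff-wronski-f i = begin
    coeff (wronski f₁ f₂) i
      ≡⟨ coeff-≡ (≈₀⇒≐ (Exact.≈-trans (W₀.wronski-cong f₁≈₀ f₂≈₀) (W₀.wronski-scale c₁ c₂ g₁ g₂))) i ⟩
    coeff (constₚ (c₁ * c₂) *ₚ wronski g₁ g₂) i
      ≡⟨ coeff-≡ (scale≐constₚ*ₚ (c₁ * c₂) (wronski g₁ g₂)) i ⟨
    coeff (scale (c₁ * c₂) (wronski g₁ g₂)) i
      ≡⟨ coeff-scale (c₁ * c₂) (wronski g₁ g₂) i ⟩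
    c₁ * c₂ * coeff (wronski g₁ g₂) i ∎
    where open ≡-Reasoning

  wronski-f≐cP : wronski f₁ f₂ ≐ scale c P
  wronski-f≐cP = ≈ₚ⇒≐ (wronski f₁ f₂) (scale c P) (proj₂ (proj₂ unram))

  coeff-wronski-g-top : coeff (wronski g₁ g₂) (a ℕ.+ b) ≡ w
  coeff-wronski-g-top = begin
    coeff (wronski g₁ g₂) (a ℕ.+ b)                      ≡⟨ cong (coeff (wronski g₁ g₂)) top-index ⟩
    coeff (wronski g₁ g₂) (d′ ℕ.+ m)                     ≡⟨ coeff-wronski-top g₁ g₂ d′ m g₁≤d g₂≤m ⟩
    (+ d - + m) * (coeff g₁ d * coeff g₂ m)              ≡⟨ cong (_* (coeff g₁ d * coeff g₂ m)) d-m≡e₃ ⟩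
    w                                                    ∎
    where
    open ≡-Reasoning
    cancel : ∀ x y → x + y - x ≡ y
    cancel = solve-∀
    d-m≡e₃ : + d - + m ≡ + e₃
    d-m≡e₃ = trans (cong (λ k → + k - + m) (sym m+e₃≡d)) (trans (cong (_- + m) (ℤ.pos-+ m e₃)) (cancel (+ m) (+ e₃)))

  coeff-P-top : coeff P (a ℕ.+ b) ≡ 1ℤ
  coeff-P-top = trans (coeff-Xₚ^-*ₚ a (X-1ₚ ^ₚ b) b) (proj₁ (coeff-X-^-top 1ℤ b))

  c≡c₁c₂w : c ≡ c₁ * c₂ * w
  c≡c₁c₂w = begin
    c                                     ≡⟨ ℤ.*-identityʳ c ⟨
    c * 1ℤ                                ≡⟨ cong (c *_) coeff-P-top ⟨
    c * coeff P (a ℕ.+ b)                 ≡⟨ coeff-scale c P (a ℕ.+ b) ⟨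
    coeff (scale c P) (a ℕ.+ b)           ≡⟨ coeff-≡ wronski-f≐cP (a ℕ.+ b) ⟨
    coeff (wronski f₁ f₂) (a ℕ.+ b)       ≡⟨ coeff-wronski-f (a ℕ.+ b) ⟩
    c₁ * c₂ * coeff (wronski g₁ g₂) (a ℕ.+ b) ≡⟨ cong (c₁ * c₂ *_) coeff-wronski-g-top ⟩
    c₁ * c₂ * w                           ∎
    where open ≡-Reasoning

  coeff-wronski-g : ∀ i → coeff (wronski g₁ g₂) i ≡ w * coeff P i
  coeff-wronski-g i = ℤ.*-cancelˡ-≡ (c₁ * c₂) _ _ {{ℤ.≢-nonZero c₁c₂≢0}} (begin
    c₁ * c₂ * coeff (wronski g₁ g₂) i ≡⟨ coeff-wronski-f i ⟨
    coeff (wronski f₁ f₂) i           ≡⟨ coeff-≡ wronski-f≐cP i ⟩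
    coeff (scale c P) i               ≡⟨ coeff-scale c P i ⟩
    c * coeff P i                     ≡⟨ cong (_* coeff P i) c≡c₁c₂w ⟩
    c₁ * c₂ * w * coeff P i           ≡⟨ ℤ.*-assoc (c₁ * c₂) w (coeff P i) ⟩
    c₁ * c₂ * (w * coeff P i)         ∎)
    where
    open ≡-Reasoning
    c₁c₂≢0 : c₁ * c₂ ≢ 0ℤ
    c₁c₂≢0 c₁c₂≡0 = c₂≢0 (i*j≡0⇒j≡0 c₁≢0 c₁c₂≡0)

  coeff-P-bottom : coeff P a ≡ -1ℤ ^ b
  coeff-P-bottom = begin
    coeff P a                    ≡⟨ cong (coeff P) (ℕ.+-identityʳ a) ⟨
    coeff P (a ℕ.+ 0)            ≡⟨ coeff-Xₚ^-*ₚ a (X-1ₚ ^ₚ b) 0 ⟩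
    coeff (X-1ₚ ^ₚ b) 0          ≡⟨ eval-0 (X-1ₚ ^ₚ b) ⟨
    eval (X-1ₚ ^ₚ b) 0ℤ          ≡⟨ eval-^ₚ X-1ₚ b 0ℤ ⟩
    -1ℤ ^ b                      ∎
    where open ≡-Reasoning

  wronski-g≐wP : wronski g₁ g₂ ≐ scale w P
  wronski-g≐wP = coeffwise λ i → trans (coeff-wronski-g i) (sym (coeff-scale w P i))

  bottom-identity : + suc a * coeff g₁ (suc a) * coeff g₂ 0 * -1ℤ ^ b ≡ w
  bottom-identity = begin
    + suc a * coeff g₁ (suc a) * coeff g₂ 0 * -1ℤ ^ b
      ≡⟨ cong (_* -1ℤ ^ b) (coeff-wronski-bottom g₁ g₂ a g₁≥e₁) ⟨
    coeff (wronski g₁ g₂) a * -1ℤ ^ b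
      ≡⟨ cong (_* -1ℤ ^ b) (trans (coeff-wronski-g a) (cong (w *_) coeff-P-bottom)) ⟩
    w * -1ℤ ^ b * -1ℤ ^ b
      ≡⟨ ℤ.*-assoc w _ _ ⟩
    w * (-1ℤ ^ b * -1ℤ ^ b)
      ≡⟨ cong (w *_) (-1^-square b) ⟩
    w * 1ℤ
      ≡⟨ ℤ.*-identityʳ w ⟩
    w ∎
    where open ≡-Reasoning

  q : Poly
  q = proj₁ ram-1

  E : ℤ
  E = + suc b * eval q 1ℤ

  f₁≈₀ramified : f₁ Exact.≈ X-1ₚ ^ₚ suc b *ₚ q +ₚ f₂
  f₁≈₀ramified = ≈-trans
    (solve 2 (λ f₁ f₂ → f₁ ⊜ ((f₁ ⊕ ⊝ f₂) ⊕ f₂)) ≈-refl f₁ f₂)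
    (+-cong (≐⇒≈ (≈ₚ⇒≐ (f₁ -ₚ f₂) (X-1ₚ ^ₚ suc b *ₚ q) (proj₁ (proj₂ ram-1)))) ≈-refl)
    where open Exact

  -- (x − 1)^(e₂ − 1) T is the Wronskian of f₁ and f₂.
  T : Poly
  T = constₚ (+ suc b) *ₚ q *ₚ f₂ +ₚ X-1ₚ *ₚ wronski q f₂

  T≈₀cXᵃ : T Exact.≈ constₚ c *ₚ Xₚ ^ₚ a
  T≈₀cXᵃ = ModZero.*-cancelˡ (X-1ₚ ^ₚ b) (ModZero.X-^≢0 1ℤ b) (≈-trans (≈-sym via-ram-1) via-unram)
    where
    open Exact
    via-ram-1 : wronski f₁ f₂ ≈ X-1ₚ ^ₚ b *ₚ T
    via-ram-1 = ≈-trans (W₀.wronski-cong f₁≈₀ramified ≈-refl)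
                (≈-trans (W₀.wronski-+ₚ-diagonal (X-1ₚ ^ₚ suc b *ₚ q) f₂) (W₀.wronski-X-^-multiple 1ℤ b q f₂))
    via-unram : wronski f₁ f₂ ≈ X-1ₚ ^ₚ b *ₚ (constₚ c *ₚ Xₚ ^ₚ a)
    via-unram = ≈-trans (≐⇒≈ (≐-trans wronski-f≐cP (scale≐constₚ*ₚ c P)))
                (solve 3 (λ C X Y → (C ⊗ (X ⊗ Y)) ⊜ (Y ⊗ (C ⊗ X))) ≈-refl (constₚ c) (Xₚ ^ₚ a) (X-1ₚ ^ₚ b))

  c≡E·f₂[1] : c ≡ E * eval f₂ 1ℤ
  c≡E·f₂[1] = begin
    c                                         ≡⟨ ℤ.*-identityʳ c ⟨
    c * 1ℤ                                    ≡⟨ cong₂ _*_ (eval-constₚ c 1ℤ) (trans (eval-^ₚ Xₚ a 1ℤ) (ℤ.^-zeroˡ a)) ⟨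
    eval (constₚ c) 1ℤ * eval (Xₚ ^ₚ a) 1ℤ   ≡⟨ eval-*ₚ (constₚ c) (Xₚ ^ₚ a) 1ℤ ⟨
    eval (constₚ c *ₚ Xₚ ^ₚ a) 1ℤ             ≡⟨ null₀-⇒≡ (Exact.eval-cong 1ℤ T≈₀cXᵃ) ⟨
    eval T 1ℤ                                 ≡⟨ eval-+ₚ (constₚ (+ suc b) *ₚ q *ₚ f₂) (X-1ₚ *ₚ wronski q f₂) 1ℤ ⟩
    eval (constₚ (+ suc b) *ₚ q *ₚ f₂) 1ℤ + eval (X-1ₚ *ₚ wronski q f₂) 1ℤ
      ≡⟨ cong₂ _+_ (trans (eval-*ₚ (constₚ (+ suc b) *ₚ q) f₂ 1ℤ)
                          (cong (_* eval f₂ 1ℤ) (trans (eval-*ₚ (constₚ (+ suc b)) q 1ℤ)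
                                                        (cong (_* eval q 1ℤ) (eval-constₚ (+ suc b) 1ℤ)))))
                   (eval-*ₚ X-1ₚ (wronski q f₂) 1ℤ) ⟩
    E * eval f₂ 1ℤ + 0ℤ                       ≡⟨ ℤ.+-identityʳ _ ⟩
    E * eval f₂ 1ℤ                            ∎
    where open ≡-Reasoning

  f₁[1]≡f₂[1] : eval f₁ 1ℤ ≡ eval f₂ 1ℤ
  f₁[1]≡f₂[1] = begin
    eval f₁ 1ℤ                                            ≡⟨ null₀-⇒≡ (Exact.eval-cong 1ℤ f₁≈₀ramified) ⟩
    eval (X-1ₚ ^ₚ suc b *ₚ q +ₚ f₂) 1ℤ                    ≡⟨ eval-+ₚ (X-1ₚ ^ₚ suc b *ₚ q) f₂ 1ℤ ⟩
    eval (X-1ₚ ^ₚ suc b *ₚ q) 1ℤ + eval f₂ 1ℤ             ≡⟨ cong (_+ eval f₂ 1ℤ) vanishes ⟩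
    0ℤ + eval f₂ 1ℤ                                       ≡⟨ ℤ.+-identityˡ _ ⟩
    eval f₂ 1ℤ                                            ∎
    where
    open ≡-Reasoning
    vanishes : eval (X-1ₚ ^ₚ suc b *ₚ q) 1ℤ ≡ 0ℤ
    vanishes = trans (eval-*ₚ (X-1ₚ ^ₚ suc b) q 1ℤ) (cong (_* eval q 1ℤ) (eval-*ₚ X-1ₚ (X-1ₚ ^ₚ b) 1ℤ))

  eval-f₁ : eval f₁ 1ℤ ≡ c₁ * eval g₁ 1ℤ
  eval-f₁ = trans (null₀-⇒≡ (Exact.eval-cong 1ℤ f₁≈₀)) (eval-scale c₁ g₁ 1ℤ)

  eval-f₂ : eval f₂ 1ℤ ≡ c₂ * eval g₂ 1ℤ
  eval-f₂ = trans (null₀-⇒≡ (Exact.eval-cong 1ℤ f₂≈₀)) (eval-scale c₂ g₂ 1ℤ)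

  c₁w≡E·g₂[1] : c₁ * w ≡ E * eval g₂ 1ℤ
  c₁w≡E·g₂[1] = ℤ.*-cancelˡ-≡ c₂ _ _ {{ℤ.≢-nonZero c₂≢0}} (begin
    c₂ * (c₁ * w)            ≡⟨ swap c₂ c₁ w ⟩
    c₁ * c₂ * w              ≡⟨ c≡c₁c₂w ⟨
    c                        ≡⟨ c≡E·f₂[1] ⟩
    E * eval f₂ 1ℤ           ≡⟨ cong (E *_) eval-f₂ ⟩
    E * (c₂ * eval g₂ 1ℤ)    ≡⟨ ℤ.*-assoc E c₂ _ ⟨
    E * c₂ * eval g₂ 1ℤ      ≡⟨ cong (_* eval g₂ 1ℤ) (ℤ.*-comm E c₂) ⟩
    c₂ * E * eval g₂ 1ℤ      ≡⟨ ℤ.*-assoc c₂ E _ ⟩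
    c₂ * (E * eval g₂ 1ℤ)    ∎)
    where
    open ≡-Reasoning
    swap : ∀ x y z → x * (y * z) ≡ y * x * z
    swap = solve-∀

  c₂w≡E·g₁[1] : c₂ * w ≡ E * eval g₁ 1ℤ
  c₂w≡E·g₁[1] = ℤ.*-cancelˡ-≡ c₁ _ _ {{ℤ.≢-nonZero c₁≢0}} (begin
    c₁ * (c₂ * w)            ≡⟨ ℤ.*-assoc c₁ c₂ w ⟨
    c₁ * c₂ * w              ≡⟨ c≡c₁c₂w ⟨
    c                        ≡⟨ c≡E·f₂[1] ⟩
    E * eval f₂ 1ℤ           ≡⟨ cong (E *_) (trans (sym f₁[1]≡f₂[1]) eval-f₁) ⟩
    E * (c₁ * eval g₁ 1ℤ)    ≡⟨ ℤ.*-assoc E c₁ _ ⟨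
    E * c₁ * eval g₁ 1ℤ      ≡⟨ cong (_* eval g₁ 1ℤ) (ℤ.*-comm E c₁) ⟩
    c₁ * E * eval g₁ 1ℤ      ≡⟨ ℤ.*-assoc c₁ E _ ⟩
    c₁ * (E * eval g₁ 1ℤ)    ∎)
    where open ≡-Reasoning

  module AtPrime {p : ℕ} (p-prime : Prime p) (sep : SeparableMod p g₁ g₂) where
    open Modulo p
    open ModPrime p-prime
    private module Wₚ = Wronskian p

    ¬null-w : ¬ Null w
    ¬null-w null-w = sep λ i → ∣⇒∣ᵤ (subst Null (sym (coeff-wronski-g i)) (∣m⇒∣m*n (coeff P i) null-w))

    ¬p∣e₃ : ¬ p ∣ e₃
    ¬p∣e₃ p∣e₃ = ¬null-w (∣m⇒∣m*n (coeff g₁ d * coeff g₂ m) (∣ᵤ⇒∣ {+ p} {+ e₃} p∣e₃))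

    ¬null-g₁[d] : ¬ Null (coeff g₁ d)
    ¬null-g₁[d] null = ¬null-w (∣n⇒∣m*n (+ e₃) (∣m⇒∣m*n (coeff g₂ m) null))

    ¬null-bottom : ¬ Null (+ suc a * coeff g₁ (suc a) * coeff g₂ 0)
    ¬null-bottom null = ¬null-w (subst Null bottom-identity (∣m⇒∣m*n (-1ℤ ^ b) null))

    ¬p∣e₁ : ¬ p ∣ suc a
    ¬p∣e₁ p∣e₁ = ¬null-bottom (∣m⇒∣m*n (coeff g₂ 0) (∣m⇒∣m*n (coeff g₁ (suc a)) (∣ᵤ⇒∣ {+ p} {+ suc a} p∣e₁)))

    ¬null-g₂[0] : ¬ Null (eval g₂ 0ℤ)
    ¬null-g₂[0] null = ¬null-bottom (∣n⇒∣m*n (+ suc a * coeff g₁ (suc a)) (subst Null (eval-0 g₂) null))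

    ¬null-c₁×c₂ : Null c₁ → Null c₂ → ⊥
    ¬null-c₁×c₂ p∣c₁ p∣c₂
      with coprime (constₚ (+ p)) (constₚ-∣ₚ-scale f₁ g₁ (≈ₚ⇒≐ f₁ (scale c₁ g₁) f₁≈c₁g₁) p∣c₁)
                                 (constₚ-∣ₚ-scale f₂ g₂ (≈ₚ⇒≐ f₂ (scale c₂ g₂) f₂≈c₂g₂) p∣c₂)
    ... | inj₁ p≈1  = ¬prime[1] (subst Prime (ℤ.+-injective (ℤ.i-j≡0⇒i≡j (+ p) 1ℤ (p≈1 0))) p-prime)
    ... | inj₂ p≈-1 = case ℤ.i-j≡0⇒i≡j (+ p) -1ℤ (p≈-1 0) of λ ()

    ¬null-E·g[1] : ¬ Null (E * eval g₁ 1ℤ) ⊎ ¬ Null (E * eval g₂ 1ℤ)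
    ¬null-E·g[1] with + p ∣? c₁
    ... | yes p∣c₁ = inj₁ λ null → ¬null-* (¬null-c₁×c₂ p∣c₁) ¬null-w (subst Null (sym c₂w≡E·g₁[1]) null)
    ... | no ¬p∣c₁ = inj₂ λ null → ¬null-* ¬p∣c₁ ¬null-w (subst Null (sym c₁w≡E·g₂[1]) null)

    ¬p∣e₂ : ¬ p ∣ suc b
    ¬p∣e₂ p∣e₂ = [ (λ ¬null → ¬null (null-E* (eval g₁ 1ℤ))) , (λ ¬null → ¬null (null-E* (eval g₂ 1ℤ))) ]′ ¬null-E·g[1]
      where
      null-E* : ∀ y → Null (E * y)
      null-E* y = ∣m⇒∣m*n y (∣m⇒∣m*n (eval q 1ℤ) (∣ᵤ⇒∣ {+ p} {+ suc b} p∣e₂))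

    coprime-mod : CoprimeMod p g₁ g₂
    coprime-mod g (h₁ , g₁-gh₁) (h₂ , g₂-gh₂) = Deg⇒HasDegMod g (unit⇒deg0 g (proj₁ gh″≈w) (proj₂ gh″≈w) ¬null-w)
      where
      g₁≈gh₁ : g₁ ≈ g *ₚ h₁
      g₁≈gh₁ = ZeroMod⇒≈ g₁-gh₁
      g₂≈gh₂ : g₂ ≈ g *ₚ h₂
      g₂≈gh₂ = ZeroMod⇒≈ g₂-gh₂
      ¬null-g[0] : ¬ Null (eval g 0ℤ)
      ¬null-g[0] = ¬null-eval-factor g h₂ 0ℤ g₂≈gh₂ ¬null-g₂[0]
      ¬null-g[1] : ¬ Null (eval g 1ℤ)
      ¬null-g[1] = [ (λ ¬null → ¬null-eval-factor g h₁ 1ℤ g₁≈gh₁ (¬null ∘ ∣n⇒∣m*n E))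
                   , (λ ¬null → ¬null-eval-factor g h₂ 1ℤ g₂≈gh₂ (¬null ∘ ∣n⇒∣m*n E)) ]′ ¬null-E·g[1]
      cofactor : Poly
      cofactor = deriv (g *ₚ h₁) *ₚ h₂ -ₚ h₁ *ₚ deriv (g *ₚ h₂)
      factored : g *ₚ cofactor ≈ Xₚ ^ₚ a *ₚ (X-1ₚ ^ₚ b *ₚ constₚ w)
      factored = begin
        g *ₚ cofactor                                         ≈⟨ Wₚ.wronski-common-factor g h₁ h₂ ⟨
        wronski (g *ₚ h₁) (g *ₚ h₂)                           ≈⟨ Wₚ.wronski-cong g₁≈gh₁ g₂≈gh₂ ⟨
        wronski g₁ g₂                                         ≈⟨ ≐⇒≈ (≐-trans wronski-g≐wP (scale≐constₚ*ₚ w P)) ⟩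
        constₚ w *ₚ (Xₚ ^ₚ a *ₚ X-1ₚ ^ₚ b)                    ≈⟨ solve 3 (λ C X Y → (C ⊗ (X ⊗ Y)) ⊜ (X ⊗ (Y ⊗ C))) ≈-refl
                                                                    (constₚ w) (Xₚ ^ₚ a) (X-1ₚ ^ₚ b) ⟩
        Xₚ ^ₚ a *ₚ (X-1ₚ ^ₚ b *ₚ constₚ w)                    ∎
        where open ≈-Reasoning
      gh′≈ : ∃ λ h′ → g *ₚ h′ ≈ X-1ₚ ^ₚ b *ₚ constₚ w
      gh′≈ = peel-X- g 0ℤ ¬null-g[0] a cofactor factored
      gh″≈w : ∃ λ h″ → g *ₚ h″ ≈ constₚ w
      gh″≈w = peel-X- g 1ℤ ¬null-g[1] b (proj₁ gh′≈) (proj₂ gh′≈)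

    rational-degree : RatDegMod p g₁ g₂ d
    rational-degree with null-or-deg g₂
    ... | inj₁ null-g₂     = ⊥-elim (¬null-g₂[0] (subst Null (sym (eval-0 g₂)) (null-g₂ 0)))
    ... | inj₂ (k , g₂≡k) =
      constₚ 1ℤ , g₁ , g₂ , ≈⇒ZeroMod (one-* g₁) , ≈⇒ZeroMod (one-* g₂) , coprime-mod ,
      d , k , Deg⇒HasDegMod g₁ (¬null-g₁[d] , λ i d<i → ≡0⇒null (g₁≤d i d<i)) , Deg⇒HasDegMod g₂ g₂≡k ,
      sym (ℕ.m≥n⇒m⊔n≡m (ℕ.≤-trans k≤m (ℕ.m∸n≤m d e₃)))
      where
      one-* : ∀ g → g ≈ constₚ 1ℤ *ₚ g
      one-* g = ≐⇒≈ (≐-sym (*ₚ-identityˡ g))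
      k≤m : k ℕ.≤ m
      k≤m = ℕ.≮⇒≥ λ m<k → proj₁ g₂≡k (≡0⇒null (g₂≤m k m<k))

belyi-shape : ∀ {d e₁ e₂ e₃ f₁ f₂} → IsNormBelyi d e₁ e₂ e₃ f₁ f₂ →
              ∃ λ d′ → ∃ λ a → ∃ λ b → d ≡ suc d′ × e₁ ≡ suc a × e₂ ≡ suc b
belyi-shape belyi with IsNormBelyi.e₁-range belyi | IsNormBelyi.e₂-range belyi
... | s≤s (s≤s _) , s≤s _ | s≤s (s≤s _) , _ = _ , _ , _ , refl , refl , refl

proposition4p5 :
    (d e₁ e₂ e₃ : ℕ) (f₁ f₂ : Poly) → IsNormBelyi d e₁ e₂ e₃ f₁ f₂ →
    (p : ℕ) → Prime p →
    (c₁ c₂ : ℤ) (g₁ g₂ : Poly) →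
    c₁ ≢ 0ℤ → c₂ ≢ 0ℤ →
    f₁ ≈ₚ scale c₁ g₁ → f₂ ≈ₚ scale c₂ g₂ →
    Primitive g₁ → Primitive g₂ →
    SeparableMod p g₁ g₂ →
    RatDegMod p g₁ g₂ d × (¬ (p ∣ e₁) × ¬ (p ∣ e₂) × ¬ (p ∣ e₃))
proposition4p5 d e₁ e₂ e₃ f₁ f₂ belyi p p-prime c₁ c₂ g₁ g₂ c₁≢0 c₂≢0 f₁≈c₁g₁ f₂≈c₂g₂ _ _ sep
  with belyi-shape belyi
... | d′ , a , b , refl , refl , refl = rational-degree , ¬p∣e₁ , ¬p∣e₂ , ¬p∣e₃
  where open Reduction.AtPrime belyi c₁≢0 c₂≢0 f₁≈c₁g₁ f₂≈c₂g₂ p-prime sep
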